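{- Let $k,N\in\mathbb{N}$ and let $a_1,a_2,\dots$ be complex numbers; put $a_0:=1$ and $$a_{n,j}:=\begin{cases}a_j & n\le N,\\ 0&\text{otherwise}\end{cases}\qquad (n,j\ge1).$$ Then $$\hat{B}_{k+N,N}(a_0,a_1,\dots,a_k)=\sum_{L\vdash k}\frac{1}{C_{stb}(L)}\sum_{\sigma\in S_{\ell(L)}}\operatorname{sign}(\sigma)\,\mathbb{A}_{\sigma,L}\big(\{a_{n,j}\}_{n,j\ge1}\big).$$
   Context: The ordinary Bell polynomial is $\hat{B}_{n,k}(x_1,\dots,x_{n-k+1})=\sum\frac{k!}{j_1!\cdots j_{n-k+1}!}x_1^{j_1}\cdots x_{n-k+1}^{j_{n-k+1}}$, summed over integers $j_1,\dots,j_{n-k+1}\ge0$ with $\sum_i j_i=k$ and $\sum_i i\,j_i=n$; thus $\hat{B}_{k+N,N}(a_0,\dots,a_k)$ means $x_i=a_{i-1}$. A partition $L\vdash k$ is a multiset $[x_1,\dots,x_m]$ of positive integers summing to $k$, $\ell(L)=m$, and $C_{stb}(L)=\prod_x(\#\{i:x_i=x\})!$ over distinct values $x$ in $L$. For $L=[k_1,\dots,k_m]$ with $k_1\le\dots\le k_m$ and $\sigma\in S_m$ written as a product of disjoint cycles $C_1,\dots,C_r$ including fixed points (each a subset of $\{1,\dots,m\}$), $\mathbb{A}_{\sigma,L}(\{a_{n,j}\}):=\prod_{s=1}^{r}\big(\sum_{n=1}^{\infty}\prod_{i\in C_s}a_{n,k_i}\big)$ (here all sums are finite). -}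

module Defs where

open import Algebra.Bundles using (CommutativeRing)
open import Data.Nat.Base as ℕ using (ℕ; zero; suc; _∸_; _≡ᵇ_; _≤ᵇ_; _<ᵇ_)
open import Data.Nat.Base using (_!)
open import Data.Fin.Base as Fin using (Fin; toℕ)
open import Data.List.Base as List using (List; []; _∷_; map; filterᵇ; concatMap; upTo; allFin; length)
open import Data.Nat.ListAction as NL using ()
open import Data.Bool.ListAction using (any; all)
open import Data.Vec.Base as Vec using (Vec; []; _∷_; lookup)
open import Data.Bool.Base using (Bool; true; false; if_then_else_; _∧_; not)
open import Data.Product.Base using (Σ; _,_)

vecsUpTo : (m b : ℕ) → List (Vec ℕ m)
vecsUpTo zero    b = [] ∷ []
vecsUpTo (suc m) b = concatMap (λ x → map (x ∷_) (vecsUpTo m b)) (upTo (suc b))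

wsumFrom : ∀ {m} → ℕ → Vec ℕ m → ℕ
wsumFrom i []       = 0
wsumFrom i (j ∷ js) = i ℕ.* j ℕ.+ wsumFrom (suc i) js

factProd : ∀ {m} → Vec ℕ m → ℕ
factProd []       = 1
factProd (j ∷ js) = (j !) ℕ.* factProd js

bellIndices : (n k : ℕ) → List (Vec ℕ (n ∸ k ℕ.+ 1))
bellIndices n k =
  filterᵇ (λ j → (Vec.sum j ≡ᵇ k) ∧ (wsumFrom 1 j ≡ᵇ n)) (vecsUpTo (n ∸ k ℕ.+ 1) k)

allPos : ∀ {m} → Vec ℕ m → Bool
allPos []       = true
allPos (x ∷ xs) = (1 ≤ᵇ x) ∧ allPos xs

nondecr : ∀ {m} → Vec ℕ m → Bool
nondecr []           = true
nondecr (x ∷ [])     = true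
nondecr (x ∷ y ∷ xs) = (x ≤ᵇ y) ∧ nondecr (y ∷ xs)

-- A partition L ⊢ k, written as (m , [k₁,…,k_m]) with k₁ ≤ … ≤ k_m, k_i ≥ 1, Σ k_i = k;
-- ℓ(L) = m.
Partition : Set
Partition = Σ ℕ (Vec ℕ)

partitionsOf : ℕ → List Partition
partitionsOf k =
  concatMap (λ m → map (m ,_)
    (filterᵇ (λ L → allPos L ∧ nondecr L ∧ (Vec.sum L ≡ᵇ k)) (vecsUpTo m k)))
    (upTo (suc k))

count : ∀ {m} → ℕ → Vec ℕ m → ℕ
count x []       = 0
count x (y ∷ ys) = (if x ≡ᵇ y then 1 else 0) ℕ.+ count x ys

-- C_stb(L) = ∏_x (#{i : x_i = x})!, over the values x ∈ {1,…,k}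
-- (values not occurring contribute 0! = 1, so this is the product over distinct values of L)
Cstb : (k : ℕ) → Partition → ℕ
Cstb k (m , L) = NL.product (map (λ x → count (suc x) L !) (upTo k))

finVecs : (m n : ℕ) → List (Vec (Fin m) n)
finVecs m zero    = [] ∷ []
finVecs m (suc n) = concatMap (λ x → map (x ∷_) (finVecs m n)) (allFin m)

_≡ᶠ_ : ∀ {m} → Fin m → Fin m → Bool
i ≡ᶠ j = toℕ i ≡ᵇ toℕ j

-- permutation σ ∈ S_m, given as the table i ↦ σ(i)
isPerm : ∀ {m} → Vec (Fin m) m → Bool
isPerm {m} σ = all (λ i → all (λ j → (i ≡ᶠ j) ∨' not (lookup σ i ≡ᶠ lookup σ j)) (allFin m)) (allFin m)
  where
  _∨'_ : Bool → Bool → Bool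
  true  ∨' _ = true
  false ∨' b = b

perms : (m : ℕ) → List (Vec (Fin m) m)
perms m = filterᵇ isPerm (finVecs m m)

inversions : ∀ {m} → Vec (Fin m) m → ℕ
inversions {m} σ =
  NL.sum (map (λ i → length (filterᵇ (λ j → (toℕ i <ᵇ toℕ j) ∧ (toℕ (lookup σ j) <ᵇ toℕ (lookup σ i))) (allFin m))) (allFin m))

even : ℕ → Bool
even zero          = true
even (suc zero)    = false
even (suc (suc n)) = even n

iter : ∀ {m} → Vec (Fin m) m → ℕ → Fin m → Fin m
iter σ zero    i = i
iter σ (suc t) i = lookup σ (iter σ t i)

inCycle : ∀ {m} → Vec (Fin m) m → Fin m → Fin m → Bool
inCycle {m} σ i j = any (λ t → iter σ t i ≡ᶠ j) (upTo m)

-- i is the least element of its cycle (one representative per cycle C_s)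
isCycleRep : ∀ {m} → Vec (Fin m) m → Fin m → Bool
isCycleRep {m} σ i = all (λ j → not ((toℕ j <ᵇ toℕ i) ∧ inCycle σ i j)) (allFin m)

module _ {c ℓ} (R : CommutativeRing c ℓ) where
  open CommutativeRing R

  rsum : List Carrier → Carrier
  rsum = List.foldr _+_ 0#

  rprod : List Carrier → Carrier
  rprod = List.foldr _*_ 1#

  fromℕ : ℕ → Carrier
  fromℕ zero    = 0#
  fromℕ (suc n) = 1# + fromℕ n

  pow : Carrier → ℕ → Carrier
  pow x zero    = 1#
  pow x (suc n) = x * pow x n

  monoFrom : ∀ {m} → (ℕ → Carrier) → ℕ → Vec ℕ m → Carrier
  monoFrom x i []       = 1#
  monoFrom x i (j ∷ js) = pow (x i) j * monoFrom x (suc i) js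

  -- ordinary Bell polynomial  B̂_{n,k}(x₁,…,x_{n-k+1});
  -- inv n plays the role of 1/n (for n ≥ 1)
  bellHat : (inv : ℕ → Carrier) → (n k : ℕ) → (x : ℕ → Carrier) → Carrier
  bellHat inv n k x =
    rsum (map (λ j → (fromℕ (k !) * inv (factProd j)) * monoFrom x 1 j) (bellIndices n k))

  sign : ∀ {m} → Vec (Fin m) m → Carrier
  sign σ = if even (inversions σ) then 1# else (- 1#)

  -- 𝔸_{σ,L}({a_{n,j}}) with the sum over n truncated to n ∈ {1,…,M}
  𝔸 : (M : ℕ) → (m : ℕ) → Vec (Fin m) m → Vec ℕ m → (ℕ → ℕ → Carrier) → Carrier
  𝔸 M m σ L a =
    rprod (map (λ i →
              rsum (map (λ n →
                rprod (map (λ j → a (suc n) (lookup L j)) (filterᵇ (inCycle σ i) (allFin m))))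
                (upTo M)))
            (filterᵇ (isCycleRep σ) (allFin m)))

  withA₀ : (ℕ → Carrier) → ℕ → Carrier
  withA₀ a zero    = 1#
  withA₀ a (suc j) = a (suc j)

  truncFam : ℕ → (ℕ → Carrier) → ℕ → ℕ → Carrier
  truncFam N a n j = if n ≤ᵇ N then a j else 0#

  -- left side: B̂_{k+N,N}(a₀,a₁,…,a_k), i.e. x_i = a_{i-1}
  lhs4p1 : (inv : ℕ → Carrier) → (k N : ℕ) → (a : ℕ → Carrier) → Carrier
  lhs4p1 inv k N a = bellHat inv (k ℕ.+ N) N (λ i → withA₀ a (i ∸ 1))

  -- right side, with the (finitely supported) sum over n ≥ 1 taken over n ≤ M
  rhs4p1 : (inv : ℕ → Carrier) → (k N M : ℕ) → (a : ℕ → Carrier) → Carrier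
  rhs4p1 inv k N M a =
    rsum (map (λ { (m , L) →
           inv (Cstb k (m , L)) *
           rsum (map (λ σ → sign σ * 𝔸 M m σ L (truncFam N a)) (perms m)) })
         (partitionsOf k))

-- Truncating a_{n,j} to n ≤ N makes every cycle factor of 𝔸_{σ,L} equal to N·∏_{i∈C} a_{k_i},
-- so 𝔸_{σ,L} = N^{c(σ)} ∏_i a_{k_i}, where c(σ) is the number of cycles of σ. Every permutation
-- of {1,…,m+1} arises from exactly one σ ∈ S_m, either by adding m+1 as a fixed point (one more
-- cycle, same sign) or by inserting m+1 into a cycle of σ right after some j (same number of
-- cycles, opposite sign); hence Σ_{σ∈S_m} sign(σ) x^{c(σ)} = x(x−1)⋯(x−m+1). The right-hand
-- side is therefore Σ_L N(N−1)⋯(N−ℓ(L)+1)/C_stb(L) · ∏_i a_{k_i}, in which partitions with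
-- ℓ(L) > N vanish. Recording the remaining partitions by their multiplicities (j_1,…,j_k),
-- together with j_0 = N − ℓ(L), is a bijection onto the exponent vectors of B̂_{k+N,N}, and
-- it matches the coefficients: N!/(j_0! j_1! ⋯ j_k!) = N(N−1)⋯(N−ℓ(L)+1)/C_stb(L).
module Submission where

open import Algebra.Bundles using (CommutativeRing)
open import Data.Bool.Base using (Bool; true; false; if_then_else_; _∧_; not; T)
open import Data.Empty using (⊥; ⊥-elim)
open import Data.Fin.Base as Fin using (Fin)
open import Data.List.Base as List using (List; []; _∷_; map; filterᵇ; upTo; allFin; length; _++_; concatMap; replicate; applyUpTo)
open import Data.List.Membership.Propositional using (_∈_)
open import Data.List.Properties as ListP using ()
open import Data.List.Relation.Binary.Permutation.Propositional using (_↭_; ↭-sym)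
open import Data.List.Relation.Binary.Permutation.Propositional.Properties as ↭P using ()
open import Data.Nat.Base as ℕ using (ℕ; zero; suc; _∸_; _≡ᵇ_; _≤ᵇ_; _<_; _≤_; s≤s; z≤n; _!)
open import Data.Nat.Properties as ℕP using ()
open import Data.Product.Base using (∃; _×_; _,_; proj₁; proj₂)
open import Data.Sum.Base using (_⊎_; inj₁; inj₂; [_,_]′)
open import Data.Vec.Base as Vec using (Vec; lookup; toList; fromList)
open import Function.Base using (_∘_; id; case_of_)
open import Relation.Binary.PropositionalEquality as ≡ using (_≡_)
open import Relation.Nullary using (¬_)

open import Defs

module Combinatorics where

  open import Data.Bool.ListAction using (all)
  open import Data.Bool.Properties using (T-∧; T-≡; ∧-comm; not-involutive)
  open import Data.Fin.Base using (toℕ; inject₁; lower₁)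
  open import Data.Fin.Properties as FinP using (toℕ-injective; toℕ<n; toℕ-inject₁; toℕ-fromℕ; inject₁-injective; inject₁-lower₁; pigeonhole)
  open import Data.Fin.Relation.Unary.Top using (View; view; ‵fromℕ; ‵inject₁)
  open import Data.List.Membership.Propositional using (find; lose)
  open import Data.List.Membership.Propositional.Properties using (∈-upTo⁺; ∈-upTo⁻; ∈-allFin; ∈-map⁺; ∈-map⁻; ∈-concat⁺′; ∈-concat⁻′; ∈-filter⁺; ∈-filter⁻; ∈-++⁻)
  open import Data.List.Membership.Propositional.Properties.WithK using (unique∧set⇒bag)
  open import Data.List.Relation.Binary.BagAndSetEquality using (∼bag⇒↭)
  open import Data.List.Relation.Unary.All as All using ([]; _∷_)
  open import Data.List.Relation.Unary.All.Properties using (all⁺; all⁻; All¬⇒¬Any; ¬Any⇒All¬)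
  open import Data.List.Relation.Unary.Any using (Any; here; there)
  open import Data.List.Relation.Unary.Any.Properties using (any⁺; any⁻)
  open import Data.List.Relation.Unary.Unique.Propositional using (Unique; []; _∷_)
  open import Data.List.Relation.Unary.Unique.Propositional.Properties as UniqueP using ()
  open import Data.Nat.Base using (_+_; _*_; _<ᵇ_)
  open import Data.Nat.DivMod using (_%_; _/_; m≡m%n+[m/n]*n; m%n<n)
  open import Data.Nat.ListAction as ℕL using ()
  open import Data.Nat.ListAction.Properties as ℕLP using ()
  open import Data.Nat.Solver using (module +-*-Solver)
  open import Algebra.Properties.CommutativeSemigroup ℕP.+-commutativeSemigroup using () renaming (interchange to +-interchange)
  open import Data.Vec.Base using (_∷ʳ_; _[_]≔_)
  open import Data.Vec.Properties using (lookup-map; lookup∘update; lookup∘update′; lookup∘tabulate; tabulate∘lookup; tabulate-cong; ∷-injective; toList∘fromList; length-toList)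
  open import Function.Bundles using (Equivalence; mk⇔)
  open import Function.Definitions using (Injective)
  open import Relation.Binary.Definitions using (tri<; tri≈; tri>)
  open import Relation.Binary.PropositionalEquality
  open import Relation.Nullary using (yes; no)
  open import Relation.Nullary.Decidable using (T?)

  private
    ∧⁺ : ∀ {a b} → T a → T b → T (a ∧ b)
    ∧⁺ p q = Equivalence.from T-∧ (p , q)

    ∧⁻ : ∀ {a b} → T (a ∧ b) → T a × T b
    ∧⁻ = Equivalence.to T-∧

    not⁺ : ∀ {b} → ¬ T b → T (not b)
    not⁺ {false} _ = _
    not⁺ {true}  f = f _

    not⁻ : ∀ {b} → T (not b) → ¬ T b
    not⁻ {false} _ ()

  -- Cycles of a permutation table

  IsPermutation : ∀ {m} → Vec (Fin m) m → Set
  IsPermutation σ = Injective _≡_ _≡_ (lookup σ)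

  Reachable : ∀ {m} → Vec (Fin m) m → Fin m → Fin m → Set
  Reachable σ i j = ∃ λ t → iter σ t i ≡ j

  ≡ᶠ⇒≡ : ∀ {m} {i j : Fin m} → T (i ≡ᶠ j) → i ≡ j
  ≡ᶠ⇒≡ {i = i} {j} h = toℕ-injective (ℕP.≡ᵇ⇒≡ (toℕ i) (toℕ j) h)

  ≡⇒≡ᶠ : ∀ {m} {i j : Fin m} → i ≡ j → T (i ≡ᶠ j)
  ≡⇒≡ᶠ {i = i} refl = ℕP.≡⇒≡ᵇ (toℕ i) (toℕ i) refl

  ≢⇒≡ᶠ-false : ∀ {m} {i j : Fin m} → i ≢ j → (i ≡ᶠ j) ≡ false
  ≢⇒≡ᶠ-false {i = i} {j} i≢j with i ≡ᶠ j in eq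
  ... | true  = ⊥-elim (i≢j (≡ᶠ⇒≡ (Equivalence.from T-≡ eq)))
  ... | false = refl

  ≡⇒≡ᶠ-true : ∀ {m} {i j : Fin m} → i ≡ j → (i ≡ᶠ j) ≡ true
  ≡⇒≡ᶠ-true = Equivalence.to T-≡ ∘ ≡⇒≡ᶠ

  iter-+ : ∀ {m} (σ : Vec (Fin m) m) t s i → iter σ (t + s) i ≡ iter σ t (iter σ s i)
  iter-+ σ zero    s i = refl
  iter-+ σ (suc t) s i = cong (lookup σ) (iter-+ σ t s i)

  iter-injective : ∀ {m} (σ : Vec (Fin m) m) → IsPermutation σ → ∀ t {x y} → iter σ t x ≡ iter σ t y → x ≡ y
  iter-injective σ perm zero    e = e
  iter-injective σ perm (suc t) e = iter-injective σ perm t (perm e)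

  iter-*-period : ∀ {m} (σ : Vec (Fin m) m) {d i} → iter σ d i ≡ i → ∀ q → iter σ (q * d) i ≡ i
  iter-*-period σ e zero    = refl
  iter-*-period σ {d} {i} e (suc q) = trans (iter-+ σ d (q * d) i) (trans (cong (iter σ d) (iter-*-period σ e q)) e)

  -- Pigeonhole on i, σ i, …, σ^m i gives σ^a i = σ^b i with a < b, and injectivity cancels σ^a.
  period : ∀ {m} (σ : Vec (Fin m) m) → IsPermutation σ → (i : Fin m) → ∃ λ d → suc d ≤ m × iter σ (suc d) i ≡ i
  period {m} σ perm i with pigeonhole (ℕP.n<1+n m) (λ (t : Fin (suc m)) → iter σ (toℕ t) i)
  ... | a , b , a<b , e = ℕ.pred d , d≤m , returns
    where
    d : ℕ
    d = toℕ b ∸ toℕ a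
    sucPred : suc (ℕ.pred d) ≡ d
    sucPred = ℕP.suc-pred d {{ℕ.>-nonZero (ℕP.m<n⇒0<n∸m a<b)}}
    d≤m : suc (ℕ.pred d) ≤ m
    d≤m = subst (_≤ m) (sym sucPred) (ℕP.≤-trans (ℕP.m∸n≤m (toℕ b) (toℕ a)) (ℕP.≤-pred (toℕ<n b)))
    shifted : iter σ (toℕ a) (iter σ d i) ≡ iter σ (toℕ a) i
    shifted = begin
      iter σ (toℕ a) (iter σ d i) ≡⟨ iter-+ σ (toℕ a) d i ⟨
      iter σ (toℕ a + d) i        ≡⟨ cong (λ t → iter σ t i) (ℕP.m+[n∸m]≡n (ℕP.<⇒≤ a<b)) ⟩
      iter σ (toℕ b) i            ≡⟨ e ⟨
      iter σ (toℕ a) i            ∎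
      where open ≡-Reasoning
    returns : iter σ (suc (ℕ.pred d)) i ≡ i
    returns = trans (cong (λ t → iter σ t i) sucPred) (iter-injective σ perm (toℕ a) shifted)

  reachable-within : ∀ {m} (σ : Vec (Fin m) m) → IsPermutation σ → ∀ {i j} → Reachable σ i j →
                     ∃ λ t → t < m × iter σ t i ≡ j
  reachable-within σ perm {i} {j} (t , e) with period σ perm i
  ... | d , d<m , returns = t % suc d , ℕP.<-≤-trans (m%n<n t (suc d)) d<m , reduced
    where
    reduced : iter σ (t % suc d) i ≡ j
    reduced = begin
      iter σ (t % suc d) i                              ≡⟨ cong (iter σ (t % suc d)) (iter-*-period σ returns (t / suc d)) ⟨
      iter σ (t % suc d) (iter σ (t / suc d * suc d) i) ≡⟨ iter-+ σ (t % suc d) _ i ⟨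
      iter σ (t % suc d + t / suc d * suc d) i          ≡⟨ cong (λ u → iter σ u i) (m≡m%n+[m/n]*n t (suc d)) ⟨
      iter σ t i                                        ≡⟨ e ⟩
      j                                                 ∎
      where open ≡-Reasoning

  inCycle⇒reachable : ∀ {m} (σ : Vec (Fin m) m) {i j} → T (inCycle σ i j) → Reachable σ i j
  inCycle⇒reachable {m} σ {i} {j} h with find (any⁻ (λ t → iter σ t i ≡ᶠ j) (upTo m) h)
  ... | t , _ , pt = t , ≡ᶠ⇒≡ pt

  reachable⇒inCycle : ∀ {m} (σ : Vec (Fin m) m) → IsPermutation σ → ∀ {i j} → Reachable σ i j → T (inCycle σ i j)
  reachable⇒inCycle σ perm {i} {j} r with reachable-within σ perm r
  ... | t , t<m , e = any⁺ (λ t → iter σ t i ≡ᶠ j) (lose (∈-upTo⁺ t<m) (≡⇒≡ᶠ e))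

  reachable-refl : ∀ {m} (σ : Vec (Fin m) m) i → Reachable σ i i
  reachable-refl σ i = 0 , refl

  reachable-trans : ∀ {m} (σ : Vec (Fin m) m) {i j k} → Reachable σ i j → Reachable σ j k → Reachable σ i k
  reachable-trans σ {i} (t , e) (s , e′) = s + t , trans (iter-+ σ s t i) (trans (cong (iter σ s) e) e′)

  reachable-sym : ∀ {m} (σ : Vec (Fin m) m) → IsPermutation σ → ∀ {i j} → Reachable σ i j → Reachable σ j i
  reachable-sym σ perm {i} {j} (t , e) with period σ perm i
  ... | d , _ , returns = t * d , back
    where
    back : iter σ (t * d) j ≡ i
    back = begin
      iter σ (t * d) j            ≡⟨ cong (iter σ (t * d)) e ⟨
      iter σ (t * d) (iter σ t i) ≡⟨ iter-+ σ (t * d) t i ⟨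
      iter σ (t * d + t) i        ≡⟨ cong (λ u → iter σ u i) (trans (ℕP.+-comm (t * d) t) (sym (ℕP.*-suc t d))) ⟩
      iter σ (t * suc d) i        ≡⟨ iter-*-period σ returns t ⟩
      i                           ∎
      where open ≡-Reasoning

  inCycle-refl : ∀ {m} (σ : Vec (Fin m) m) → IsPermutation σ → ∀ i → T (inCycle σ i i)
  inCycle-refl σ perm i = reachable⇒inCycle σ perm (reachable-refl σ i)

  isCycleRep⇒minimal : ∀ {m} (σ : Vec (Fin m) m) {i} → T (isCycleRep σ i) → ∀ j → toℕ j < toℕ i → ¬ T (inCycle σ i j)
  isCycleRep⇒minimal {m} σ {i} h j j<i c =
    not⁻ (All.lookup (all⁺ _ (allFin m) h) (∈-allFin j)) (∧⁺ (ℕP.<⇒<ᵇ j<i) c)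

  minimal⇒isCycleRep : ∀ {m} (σ : Vec (Fin m) m) i → (∀ j → toℕ j < toℕ i → ¬ T (inCycle σ i j)) → T (isCycleRep σ i)
  minimal⇒isCycleRep {m} σ i h = all⁻ _ (All.tabulate {xs = allFin m} λ {j} _ → not⁺ λ t →
    let j<ᵇi , c = ∧⁻ t in h j (ℕP.<ᵇ⇒< (toℕ j) (toℕ i) j<ᵇi) c)

  least-satisfying : ∀ {m} (p : Fin m → Bool) {x} → T (p x) → ∃ λ y → T (p y) × (∀ z → toℕ z < toℕ y → ¬ T (p z))
  least-satisfying {suc m} p {x} px with p Fin.zero in eq
  ... | true = Fin.zero , Equivalence.from T-≡ eq , λ z ()
  least-satisfying {suc m} p {Fin.zero} px | false = ⊥-elim (subst T eq px)
  least-satisfying {suc m} p {Fin.suc x} px | false with least-satisfying (p ∘ Fin.suc) px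
  ... | y , py , least = Fin.suc y , py , below
    where
    below : ∀ z → toℕ z < toℕ (Fin.suc y) → ¬ T (p z)
    below Fin.zero    _         pz = subst T eq pz
    below (Fin.suc z) (s≤s z<y) pz = least z z<y pz

  IsRepOf : ∀ {m} → Vec (Fin m) m → Fin m → Fin m → Bool
  IsRepOf σ j i = isCycleRep σ i ∧ inCycle σ i j

  -- The representative of the cycle of j is the least element reachable from j.
  cycleRep-exists : ∀ {m} (σ : Vec (Fin m) m) → IsPermutation σ → ∀ j → ∃ λ i → T (IsRepOf σ j i)
  cycleRep-exists σ perm j with least-satisfying (inCycle σ j) (inCycle-refl σ perm j)
  ... | i , j↝i , least = i , ∧⁺ rep (reachable⇒inCycle σ perm (reachable-sym σ perm (inCycle⇒reachable σ j↝i)))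
    where
    rep : T (isCycleRep σ i)
    rep = minimal⇒isCycleRep σ i λ z z<i i↝z →
      least z z<i (reachable⇒inCycle σ perm (reachable-trans σ (inCycle⇒reachable σ j↝i) (inCycle⇒reachable σ i↝z)))

  inCycle-converge : ∀ {m} (σ : Vec (Fin m) m) → IsPermutation σ → ∀ {a b j} →
                     T (inCycle σ a j) → T (inCycle σ b j) → T (inCycle σ a b)
  inCycle-converge σ perm a↝j b↝j = reachable⇒inCycle σ perm
    (reachable-trans σ (inCycle⇒reachable σ a↝j) (reachable-sym σ perm (inCycle⇒reachable σ b↝j)))

  cycleRep-unique : ∀ {m} (σ : Vec (Fin m) m) → IsPermutation σ → ∀ {j i i′} → T (IsRepOf σ j i) → T (IsRepOf σ j i′) → i ≡ i′
  cycleRep-unique σ perm {j} {i} {i′} h h′ with ∧⁻ h | ∧⁻ h′ | ℕP.<-cmp (toℕ i) (toℕ i′)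
  ... | _ , _ | _ , _ | tri≈ _ e _ = toℕ-injective e
  ... | _ , i↝j | rep′ , i′↝j | tri< i<i′ _ _ =
    ⊥-elim (isCycleRep⇒minimal σ rep′ i i<i′ (inCycle-converge σ perm i′↝j i↝j))
  ... | rep , i↝j | _ , i′↝j | tri> _ _ i′<i =
    ⊥-elim (isCycleRep⇒minimal σ rep i′ i′<i (inCycle-converge σ perm i↝j i′↝j))

  isPerm⇒permutation : ∀ {m} (σ : Vec (Fin m) m) → T (isPerm σ) → IsPermutation σ
  isPerm⇒permutation {m} σ h {x} {y} e with All.lookup (all⁺ _ _ (All.lookup (all⁺ _ _ h) (∈-allFin x))) (∈-allFin y)
  ... | entry with x ≡ᶠ y in x≟y
  ...   | true  = ≡ᶠ⇒≡ (Equivalence.from T-≡ x≟y)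
  ...   | false = ⊥-elim (not⁻ entry (≡⇒≡ᶠ e))

  all-false⇒witness : ∀ {A : Set} (p : A → Bool) xs → all p xs ≡ false → ∃ λ x → x ∈ xs × p x ≡ false
  all-false⇒witness p (x ∷ xs) h with p x in px
  ... | false = x , here refl , px
  ... | true with all-false⇒witness p xs h
  ...   | y , y∈ , py = y , there y∈ , py

  -- isPerm is a conjunction of clauses (i ≡ᶠ j) ∨ ¬(σ i ≡ᶠ σ j); a failing clause contradicts injectivity.
  permutation⇒isPerm : ∀ {m} (σ : Vec (Fin m) m) → IsPermutation σ → T (isPerm σ)
  permutation⇒isPerm {m} σ perm with isPerm σ in isPermσ
  ... | true = _
  ... | false with all-false⇒witness _ (allFin m) isPermσ
  ... | x , _ , row with all-false⇒witness _ (allFin m) row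
  ... | y , _ , clause with x ≡ᶠ y in x≟y
  ...   | true = case clause of λ ()
  ...   | false with lookup σ x ≡ᶠ lookup σ y in σx≟σy
  ...     | true  = case trans (sym (≡⇒≡ᶠ-true (perm (≡ᶠ⇒≡ (Equivalence.from T-≡ σx≟σy))))) x≟y of λ ()
  ...     | false = case clause of λ ()

  -- Extending a permutation of Fin m to Fin (suc m)

  lookup-∷ʳ-inject₁ : ∀ {A : Set} {n} (xs : Vec A n) x i → lookup (xs ∷ʳ x) (inject₁ i) ≡ lookup xs i
  lookup-∷ʳ-inject₁ (y Vec.∷ xs) x Fin.zero    = refl
  lookup-∷ʳ-inject₁ (y Vec.∷ xs) x (Fin.suc i) = lookup-∷ʳ-inject₁ xs x i

  lookup-∷ʳ-fromℕ : ∀ {A : Set} {n} (xs : Vec A n) x → lookup (xs ∷ʳ x) (Fin.fromℕ n) ≡ x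
  lookup-∷ʳ-fromℕ Vec.[]       x = refl
  lookup-∷ʳ-fromℕ (y Vec.∷ xs) x = lookup-∷ʳ-fromℕ xs x

  inject₁≢fromℕ : ∀ {m} (x : Fin m) → inject₁ x ≢ Fin.fromℕ m
  inject₁≢fromℕ x e = FinP.fromℕ≢inject₁ (sym e)

  inject₁<fromℕ : ∀ {m} (x : Fin m) → toℕ (inject₁ x) < toℕ (Fin.fromℕ m)
  inject₁<fromℕ {m} x = subst₂ _<_ (sym (toℕ-inject₁ x)) (sym (toℕ-fromℕ m)) (toℕ<n x)

  -- The new point is larger than every old one, so it never disqualifies an old representative.
  isCycleRep-restrict : ∀ {m} (σ : Vec (Fin m) m) (τ : Vec (Fin (suc m)) (suc m)) →
    IsPermutation σ → IsPermutation τ →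
    (∀ i j → Reachable τ (inject₁ i) (inject₁ j) → Reachable σ i j) →
    (∀ i j → Reachable σ i j → Reachable τ (inject₁ i) (inject₁ j)) →
    ∀ i → isCycleRep τ (inject₁ i) ≡ isCycleRep σ i
  isCycleRep-restrict {m} σ τ σ-perm τ-perm restrict extend i = bool-ext
    (λ h → minimal⇒isCycleRep σ i λ j j<i c → isCycleRep⇒minimal τ h (inject₁ j)
             (subst₂ _<_ (sym (toℕ-inject₁ j)) (sym (toℕ-inject₁ i)) j<i) (sameCycle i j c))
    (λ h → minimal⇒isCycleRep τ (inject₁ i) λ j′ j′<i c → below j′ (view j′) j′<i c h)
    where
    bool-ext : ∀ {a b} → (T a → T b) → (T b → T a) → a ≡ b
    bool-ext {false} {false} _ _ = refl
    bool-ext {false} {true}  _ g = ⊥-elim (g _)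
    bool-ext {true}  {false} f _ = ⊥-elim (f _)
    bool-ext {true}  {true}  _ _ = refl
    sameCycle : ∀ i j → T (inCycle σ i j) → T (inCycle τ (inject₁ i) (inject₁ j))
    sameCycle i j c = reachable⇒inCycle τ τ-perm (extend i j (inCycle⇒reachable σ c))
    below : ∀ j′ → View j′ → toℕ j′ < toℕ (inject₁ i) →
            T (inCycle τ (inject₁ i) j′) → T (isCycleRep σ i) → ⊥
    below .(inject₁ j) (‵inject₁ j) j<i c h = isCycleRep⇒minimal σ h j
      (subst₂ _<_ (toℕ-inject₁ j) (toℕ-inject₁ i) j<i) (reachable⇒inCycle σ σ-perm (restrict i j (inCycle⇒reachable τ c)))
    below .(Fin.fromℕ m) ‵fromℕ top<i c h = ℕP.<-asym top<i (inject₁<fromℕ i)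

  addFixedPoint : ∀ {m} → Vec (Fin m) m → Vec (Fin (suc m)) (suc m)
  addFixedPoint {m} σ = Vec.map inject₁ σ ∷ʳ Fin.fromℕ m

  insertAfter : ∀ {m} → Vec (Fin m) m → Fin m → Vec (Fin (suc m)) (suc m)
  insertAfter {m} σ j = (Vec.map inject₁ σ [ j ]≔ Fin.fromℕ m) ∷ʳ inject₁ (lookup σ j)

  module _ {m} (σ : Vec (Fin m) m) where

    private
      σ′ : Fin m → Vec (Fin (suc m)) m
      σ′ j = Vec.map inject₁ σ [ j ]≔ Fin.fromℕ m

    addFixedPoint-inject₁ : ∀ x → lookup (addFixedPoint σ) (inject₁ x) ≡ inject₁ (lookup σ x)
    addFixedPoint-inject₁ x = trans (lookup-∷ʳ-inject₁ (Vec.map inject₁ σ) _ x) (lookup-map x inject₁ σ)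

    addFixedPoint-fromℕ : lookup (addFixedPoint σ) (Fin.fromℕ m) ≡ Fin.fromℕ m
    addFixedPoint-fromℕ = lookup-∷ʳ-fromℕ (Vec.map inject₁ σ) _

    insertAfter-inject₁ : ∀ j {x} → x ≢ j → lookup (insertAfter σ j) (inject₁ x) ≡ inject₁ (lookup σ x)
    insertAfter-inject₁ j {x} x≢j =
      trans (lookup-∷ʳ-inject₁ (σ′ j) _ x) (trans (lookup∘update′ x≢j (Vec.map inject₁ σ) _) (lookup-map x inject₁ σ))

    insertAfter-self : ∀ j → lookup (insertAfter σ j) (inject₁ j) ≡ Fin.fromℕ m
    insertAfter-self j = trans (lookup-∷ʳ-inject₁ (σ′ j) _ j) (lookup∘update j (Vec.map inject₁ σ) _)

    insertAfter-fromℕ : ∀ j → lookup (insertAfter σ j) (Fin.fromℕ m) ≡ inject₁ (lookup σ j)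
    insertAfter-fromℕ j = lookup-∷ʳ-fromℕ (σ′ j) _

    insertAfter-cases : ∀ j x → (x ≡ j × lookup (insertAfter σ j) (inject₁ x) ≡ Fin.fromℕ m)
                              ⊎ (x ≢ j × lookup (insertAfter σ j) (inject₁ x) ≡ inject₁ (lookup σ x))
    insertAfter-cases j x with x FinP.≟ j
    ... | yes refl = inj₁ (refl , insertAfter-self j)
    ... | no x≢j   = inj₂ (x≢j , insertAfter-inject₁ j x≢j)

    addFixedPoint-permutation : IsPermutation σ → IsPermutation (addFixedPoint σ)
    addFixedPoint-permutation perm {a} {b} e with view a | view b
    ... | ‵inject₁ x | ‵inject₁ y = cong inject₁ (perm (inject₁-injective
            (trans (sym (addFixedPoint-inject₁ x)) (trans e (addFixedPoint-inject₁ y)))))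
    ... | ‵inject₁ x | ‵fromℕ = ⊥-elim (inject₁≢fromℕ _ (trans (sym (addFixedPoint-inject₁ x)) (trans e addFixedPoint-fromℕ)))
    ... | ‵fromℕ | ‵inject₁ y = ⊥-elim (inject₁≢fromℕ _ (trans (sym (addFixedPoint-inject₁ y)) (trans (sym e) addFixedPoint-fromℕ)))
    ... | ‵fromℕ | ‵fromℕ = refl

    insertAfter-permutation : ∀ j → IsPermutation σ → IsPermutation (insertAfter σ j)
    insertAfter-permutation j perm {a} {b} e with view a | view b
    ... | ‵fromℕ | ‵fromℕ = refl
    ... | ‵inject₁ x | ‵inject₁ y with insertAfter-cases j x | insertAfter-cases j y
    ...   | inj₁ (refl , _) | inj₁ (refl , _) = refl
    ...   | inj₁ (_ , ex) | inj₂ (_ , ey) = ⊥-elim (inject₁≢fromℕ _ (trans (sym ey) (trans (sym e) ex)))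
    ...   | inj₂ (_ , ex) | inj₁ (_ , ey) = ⊥-elim (inject₁≢fromℕ _ (trans (sym ex) (trans e ey)))
    ...   | inj₂ (_ , ex) | inj₂ (_ , ey) = cong inject₁ (perm (inject₁-injective (trans (sym ex) (trans e ey))))
    insertAfter-permutation j perm e | ‵inject₁ x | ‵fromℕ with insertAfter-cases j x
    ...   | inj₁ (_ , ex) = ⊥-elim (inject₁≢fromℕ _ (trans (sym (insertAfter-fromℕ j)) (trans (sym e) ex)))
    ...   | inj₂ (x≢j , ex) = ⊥-elim (x≢j (perm (inject₁-injective (trans (sym ex) (trans e (insertAfter-fromℕ j))))))
    insertAfter-permutation j perm e | ‵fromℕ | ‵inject₁ y with insertAfter-cases j y
    ...   | inj₁ (_ , ey) = ⊥-elim (inject₁≢fromℕ _ (trans (sym (insertAfter-fromℕ j)) (trans e ey)))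
    ...   | inj₂ (y≢j , ey) = ⊥-elim (y≢j (perm (inject₁-injective (trans (sym ey) (trans (sym e) (insertAfter-fromℕ j))))))

    iter-addFixedPoint-inject₁ : ∀ t i → iter (addFixedPoint σ) t (inject₁ i) ≡ inject₁ (iter σ t i)
    iter-addFixedPoint-inject₁ zero    i = refl
    iter-addFixedPoint-inject₁ (suc t) i = trans (cong (lookup (addFixedPoint σ)) (iter-addFixedPoint-inject₁ t i)) (addFixedPoint-inject₁ _)

    iter-addFixedPoint-fromℕ : ∀ t → iter (addFixedPoint σ) t (Fin.fromℕ m) ≡ Fin.fromℕ m
    iter-addFixedPoint-fromℕ zero    = refl
    iter-addFixedPoint-fromℕ (suc t) = trans (cong (lookup (addFixedPoint σ)) (iter-addFixedPoint-fromℕ t)) addFixedPoint-fromℕ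

    -- A σ-orbit of inject₁ i is followed by insertAfter σ j, with one detour through the new
    -- point whenever the orbit passes j.
    iter-insertAfter-simulates : ∀ j i t → ∃ λ t′ → iter (insertAfter σ j) t′ (inject₁ i) ≡ inject₁ (iter σ t i)
    iter-insertAfter-simulates j i zero = 0 , refl
    iter-insertAfter-simulates j i (suc t) with iter-insertAfter-simulates j i t
    ... | t′ , e with insertAfter-cases j (iter σ t i)
    ...   | inj₁ (at-j , ex) = suc (suc t′) , trans (cong (lookup (insertAfter σ j)) (trans (cong (lookup (insertAfter σ j)) e) ex))
              (trans (insertAfter-fromℕ j) (cong (λ z → inject₁ (lookup σ z)) (sym at-j)))
    ...   | inj₂ (_ , ex) = suc t′ , trans (cong (lookup (insertAfter σ j)) e) ex

    iter-insertAfter-projects : ∀ j i t →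
      (∃ λ s → iter (insertAfter σ j) t (inject₁ i) ≡ inject₁ (iter σ s i)) ⊎
      (iter (insertAfter σ j) t (inject₁ i) ≡ Fin.fromℕ m × Reachable σ i j)
    iter-insertAfter-projects j i zero = inj₁ (0 , refl)
    iter-insertAfter-projects j i (suc t) with iter-insertAfter-projects j i t
    ... | inj₁ (s , e) with insertAfter-cases j (iter σ s i)
    ...   | inj₁ (at-j , ex) = inj₂ (trans (cong (lookup (insertAfter σ j)) e) ex , s , at-j)
    ...   | inj₂ (_ , ex) = inj₁ (suc s , trans (cong (lookup (insertAfter σ j)) e) ex)
    iter-insertAfter-projects j i (suc t) | inj₂ (e , s , at-j) =
      inj₁ (suc s , trans (cong (lookup (insertAfter σ j)) e)
                          (trans (insertAfter-fromℕ j) (cong (λ z → inject₁ (lookup σ z)) (sym at-j))))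

    reachable-addFixedPoint : ∀ i j → Reachable (addFixedPoint σ) (inject₁ i) (inject₁ j) → Reachable σ i j
    reachable-addFixedPoint i j (t , e) = t , inject₁-injective (trans (sym (iter-addFixedPoint-inject₁ t i)) e)

    addFixedPoint-reachable : ∀ i j → Reachable σ i j → Reachable (addFixedPoint σ) (inject₁ i) (inject₁ j)
    addFixedPoint-reachable i j (t , e) = t , trans (iter-addFixedPoint-inject₁ t i) (cong inject₁ e)

    reachable-insertAfter : ∀ k i j → Reachable (insertAfter σ k) (inject₁ i) (inject₁ j) → Reachable σ i j
    reachable-insertAfter k i j (t , e) with iter-insertAfter-projects k i t
    ... | inj₁ (s , e′) = s , inject₁-injective (trans (sym e′) e)
    ... | inj₂ (e′ , _) = ⊥-elim (inject₁≢fromℕ j (trans (sym e) e′))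

    insertAfter-reachable : ∀ k i j → Reachable σ i j → Reachable (insertAfter σ k) (inject₁ i) (inject₁ j)
    insertAfter-reachable k i j (t , e) with iter-insertAfter-simulates k i t
    ... | t′ , e′ = t′ , trans e′ (cong inject₁ e)

    isCycleRep-addFixedPoint : IsPermutation σ → ∀ i → isCycleRep (addFixedPoint σ) (inject₁ i) ≡ isCycleRep σ i
    isCycleRep-addFixedPoint perm = isCycleRep-restrict σ (addFixedPoint σ) perm (addFixedPoint-permutation perm)
      reachable-addFixedPoint addFixedPoint-reachable

    isCycleRep-addFixedPoint-fromℕ : isCycleRep (addFixedPoint σ) (Fin.fromℕ m) ≡ true
    isCycleRep-addFixedPoint-fromℕ = Equivalence.to T-≡ (minimal⇒isCycleRep (addFixedPoint σ) (Fin.fromℕ m)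
      λ j j<m c → let t , e = inCycle⇒reachable (addFixedPoint σ) c in
        ℕP.<-irrefl (cong toℕ (trans (sym e) (iter-addFixedPoint-fromℕ t))) j<m)

    isCycleRep-insertAfter : ∀ j → IsPermutation σ → ∀ i → isCycleRep (insertAfter σ j) (inject₁ i) ≡ isCycleRep σ i
    isCycleRep-insertAfter j perm = isCycleRep-restrict σ (insertAfter σ j) perm (insertAfter-permutation j perm)
      (reachable-insertAfter j) (insertAfter-reachable j)

    isCycleRep-insertAfter-fromℕ : ∀ j → IsPermutation σ → isCycleRep (insertAfter σ j) (Fin.fromℕ m) ≡ false
    isCycleRep-insertAfter-fromℕ j perm with isCycleRep (insertAfter σ j) (Fin.fromℕ m) in rep
    ... | false = refl
    ... | true  = ⊥-elim (isCycleRep⇒minimal (insertAfter σ j) (Equivalence.from T-≡ rep) (inject₁ (lookup σ j)) (inject₁<fromℕ _)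
                   (reachable⇒inCycle (insertAfter σ j) (insertAfter-permutation j perm) (1 , insertAfter-fromℕ j)))

  unique-⊆-⊇⇒↭ : ∀ {A : Set} {xs ys : List A} → Unique xs → Unique ys →
                  (∀ {x} → x ∈ xs → x ∈ ys) → (∀ {x} → x ∈ ys → x ∈ xs) → xs ↭ ys
  unique-⊆-⊇⇒↭ ux uy f g = ∼bag⇒↭ (unique∧set⇒bag ux uy (mk⇔ f g))

  sumFin : (m : ℕ) → (Fin m → ℕ) → ℕ
  sumFin zero    g = 0
  sumFin (suc m) g = g Fin.zero + sumFin m (g ∘ Fin.suc)

  𝟙 : Bool → ℕ
  𝟙 true  = 1
  𝟙 false = 0

  sumFin-cong : ∀ m {g h : Fin m → ℕ} → (∀ x → g x ≡ h x) → sumFin m g ≡ sumFin m h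
  sumFin-cong zero    e = refl
  sumFin-cong (suc m) e = cong₂ _+_ (e Fin.zero) (sumFin-cong m (e ∘ Fin.suc))

  sumFin-+ : ∀ m (g h : Fin m → ℕ) → sumFin m (λ x → g x + h x) ≡ sumFin m g + sumFin m h
  sumFin-+ zero    g h = refl
  sumFin-+ (suc m) g h = trans (cong (g Fin.zero + h Fin.zero +_) (sumFin-+ m (g ∘ Fin.suc) (h ∘ Fin.suc)))
    (+-interchange (g Fin.zero) (h Fin.zero) _ _)

  sumFin-0 : ∀ m → sumFin m (λ _ → 0) ≡ 0
  sumFin-0 zero    = refl
  sumFin-0 (suc m) = sumFin-0 m

  sumFin-1 : ∀ m → sumFin m (λ _ → 1) ≡ m
  sumFin-1 zero    = refl
  sumFin-1 (suc m) = cong suc (sumFin-1 m)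

  sumFin-inject₁-fromℕ : ∀ m (g : Fin (suc m) → ℕ) → sumFin (suc m) g ≡ sumFin m (g ∘ inject₁) + g (Fin.fromℕ m)
  sumFin-inject₁-fromℕ zero    g = ℕP.+-comm (g Fin.zero) 0
  sumFin-inject₁-fromℕ (suc m) g = trans (cong (g Fin.zero +_) (sumFin-inject₁-fromℕ m (g ∘ Fin.suc)))
    (sym (ℕP.+-assoc (g Fin.zero) _ _))

  sum-map-allFin : ∀ m (g : Fin m → ℕ) → ℕL.sum (map g (allFin m)) ≡ sumFin m g
  sum-map-allFin m g = sum-map-tabulate m id
    where
    sum-map-tabulate : ∀ {A : Set} m (f : Fin m → A) {g : A → ℕ} → ℕL.sum (map g (List.tabulate f)) ≡ sumFin m (g ∘ f)
    sum-map-tabulate zero    f     = refl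
    sum-map-tabulate (suc m) f {g} = cong (g (f Fin.zero) +_) (sum-map-tabulate m (f ∘ Fin.suc))

  length-filterᵇ : ∀ {A : Set} (p : A → Bool) xs → length (filterᵇ p xs) ≡ ℕL.sum (map (𝟙 ∘ p) xs)
  length-filterᵇ p []       = refl
  length-filterᵇ p (x ∷ xs) with p x
  ... | true  = cong suc (length-filterᵇ p xs)
  ... | false = length-filterᵇ p xs

  length-filterᵇ-allFin : ∀ m (p : Fin m → Bool) → length (filterᵇ p (allFin m)) ≡ sumFin m (𝟙 ∘ p)
  length-filterᵇ-allFin m p = trans (length-filterᵇ p (allFin m)) (sum-map-allFin m (𝟙 ∘ p))

  sumFin-agreeOff : ∀ m (f f′ : Fin m → ℕ) j → (∀ y → y ≢ j → f y ≡ f′ y) → sumFin m f + f′ j ≡ sumFin m f′ + f j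
  sumFin-agreeOff (suc m) f f′ Fin.zero e = begin
    f Fin.zero + sumFin m (f ∘ Fin.suc) + f′ Fin.zero  ≡⟨ cong (λ z → f Fin.zero + z + f′ Fin.zero) (sumFin-cong m (λ y → e (Fin.suc y) λ ())) ⟩
    f Fin.zero + sumFin m (f′ ∘ Fin.suc) + f′ Fin.zero ≡⟨ solve 3 (λ a b c → a :+ b :+ c := c :+ b :+ a) refl (f Fin.zero) _ _ ⟩
    f′ Fin.zero + sumFin m (f′ ∘ Fin.suc) + f Fin.zero ∎
    where open ≡-Reasoning
          open +-*-Solver
  sumFin-agreeOff (suc m) f f′ (Fin.suc j) e = begin
    f Fin.zero + sumFin m (f ∘ Fin.suc) + f′ (Fin.suc j)   ≡⟨ ℕP.+-assoc (f Fin.zero) _ _ ⟩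
    f Fin.zero + (sumFin m (f ∘ Fin.suc) + f′ (Fin.suc j)) ≡⟨ cong₂ _+_ (e Fin.zero (λ ()))
       (sumFin-agreeOff m (f ∘ Fin.suc) (f′ ∘ Fin.suc) j (λ y y≢j → e (Fin.suc y) (y≢j ∘ FinP.suc-injective))) ⟩
    f′ Fin.zero + (sumFin m (f′ ∘ Fin.suc) + f (Fin.suc j)) ≡⟨ ℕP.+-assoc (f′ Fin.zero) _ _ ⟨
    f′ Fin.zero + sumFin m (f′ ∘ Fin.suc) + f (Fin.suc j)   ∎
    where open ≡-Reasoning

  sumFin-δ : ∀ m (j : Fin m) c → sumFin m (λ y → if y ≡ᶠ j then c else 0) ≡ c
  sumFin-δ m j c = begin
    sumFin m δ                                 ≡⟨ ℕP.+-identityʳ _ ⟨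
    sumFin m δ + 0                             ≡⟨ sumFin-agreeOff m δ (λ _ → 0) j off-j ⟩
    sumFin m (λ _ → 0) + δ j                   ≡⟨ cong₂ _+_ (sumFin-0 m) (cong (λ b → if b then c else 0) (≡⇒≡ᶠ-true {i = j} refl)) ⟩
    c                                          ∎
    where
    open ≡-Reasoning
    δ : Fin m → ℕ
    δ y = if y ≡ᶠ j then c else 0
    off-j : ∀ y → y ≢ j → δ y ≡ 0
    off-j y y≢j = cong (λ b → if b then c else 0) (≢⇒≡ᶠ-false y≢j)

  sumFin-< : ∀ m k → k ≤ m → sumFin m (λ y → 𝟙 (toℕ y <ᵇ k)) ≡ k
  sumFin-< m       zero    _         = sumFin-0 m
  sumFin-< (suc m) (suc k) (s≤s k≤m) = cong suc (sumFin-< m k k≤m)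

  sumFin-> : ∀ m k → sumFin m (λ y → 𝟙 (k <ᵇ toℕ y)) ≡ m ∸ suc k
  sumFin-> zero    k       = refl
  sumFin-> (suc m) zero    = sumFin-1 m
  sumFin-> (suc m) (suc k) = sumFin-> m k

  permutation-surjective : ∀ {m} (σ : Vec (Fin m) m) → IsPermutation σ → ∀ y → ∃ λ x → lookup σ x ≡ y
  permutation-surjective σ perm y with period σ perm y
  ... | d , _ , returns = iter σ d y , returns

  sumFin-permute : ∀ m (σ : Vec (Fin m) m) → IsPermutation σ → (g : Fin m → ℕ) → sumFin m (g ∘ lookup σ) ≡ sumFin m g
  sumFin-permute m σ perm g = begin
    sumFin m (g ∘ lookup σ)                        ≡⟨ sum-map-allFin m (g ∘ lookup σ) ⟨
    ℕL.sum (map (g ∘ lookup σ) (allFin m))         ≡⟨ cong ℕL.sum (ListP.map-∘ (allFin m)) ⟩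
    ℕL.sum (map g (map (lookup σ) (allFin m)))     ≡⟨ ℕLP.sum-↭ (↭P.map⁺ g σ[allFin]↭allFin) ⟩
    ℕL.sum (map g (allFin m))                      ≡⟨ sum-map-allFin m g ⟩
    sumFin m g                                     ∎
    where
    open ≡-Reasoning
    σ[allFin]↭allFin : map (lookup σ) (allFin m) ↭ allFin m
    σ[allFin]↭allFin = unique-⊆-⊇⇒↭ (UniqueP.map⁺ perm (UniqueP.allFin⁺ m)) (UniqueP.allFin⁺ m) (λ {x} _ → ∈-allFin x)
      (λ {y} _ → let x , σx≡y = permutation-surjective σ perm y in
                 subst (_∈ map (lookup σ) (allFin m)) σx≡y (∈-map⁺ (lookup σ) (∈-allFin x)))

  -- Cycles and inversions of the two extensions

  #cycles : ∀ {m} → Vec (Fin m) m → ℕ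
  #cycles {m} σ = length (filterᵇ (isCycleRep σ) (allFin m))

  #cycles-restrict : ∀ {m} (σ : Vec (Fin m) m) (τ : Vec (Fin (suc m)) (suc m)) →
                     (∀ i → isCycleRep τ (inject₁ i) ≡ isCycleRep σ i) →
                     #cycles τ ≡ #cycles σ + 𝟙 (isCycleRep τ (Fin.fromℕ m))
  #cycles-restrict {m} σ τ sameReps = begin
    #cycles τ                                                                   ≡⟨ length-filterᵇ-allFin (suc m) (isCycleRep τ) ⟩
    sumFin (suc m) (𝟙 ∘ isCycleRep τ)                                           ≡⟨ sumFin-inject₁-fromℕ m (𝟙 ∘ isCycleRep τ) ⟩
    sumFin m (𝟙 ∘ isCycleRep τ ∘ inject₁) + 𝟙 (isCycleRep τ (Fin.fromℕ m))     ≡⟨ cong (_+ _) (sumFin-cong m (cong 𝟙 ∘ sameReps)) ⟩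
    sumFin m (𝟙 ∘ isCycleRep σ) + 𝟙 (isCycleRep τ (Fin.fromℕ m))               ≡⟨ cong (_+ _) (length-filterᵇ-allFin m (isCycleRep σ)) ⟨
    #cycles σ + 𝟙 (isCycleRep τ (Fin.fromℕ m))                                 ∎
    where open ≡-Reasoning

  #cycles-addFixedPoint : ∀ {m} (σ : Vec (Fin m) m) → IsPermutation σ → #cycles (addFixedPoint σ) ≡ suc (#cycles σ)
  #cycles-addFixedPoint σ perm = trans (#cycles-restrict σ (addFixedPoint σ) (isCycleRep-addFixedPoint σ perm))
    (trans (cong (λ b → #cycles σ + 𝟙 b) (isCycleRep-addFixedPoint-fromℕ σ)) (ℕP.+-comm (#cycles σ) 1))

  #cycles-insertAfter : ∀ {m} (σ : Vec (Fin m) m) j → IsPermutation σ → #cycles (insertAfter σ j) ≡ #cycles σ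
  #cycles-insertAfter σ j perm = trans (#cycles-restrict σ (insertAfter σ j) (isCycleRep-insertAfter σ j perm))
    (trans (cong (λ b → #cycles σ + 𝟙 b) (isCycleRep-insertAfter-fromℕ σ j perm)) (ℕP.+-identityʳ (#cycles σ)))

  isInversion : ∀ {n} → Vec (Fin n) n → Fin n → Fin n → ℕ
  isInversion τ i j = 𝟙 ((toℕ i <ᵇ toℕ j) ∧ (toℕ (lookup τ j) <ᵇ toℕ (lookup τ i)))

  inversions-sumFin : ∀ {n} (τ : Vec (Fin n) n) → inversions τ ≡ sumFin n (λ i → sumFin n (isInversion τ i))
  inversions-sumFin {n} τ = trans (cong ℕL.sum (ListP.map-cong (λ i → length-filterᵇ-allFin n _) (allFin n)))
    (sum-map-allFin n (λ i → sumFin n (isInversion τ i)))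

  <ᵇ-false : ∀ a b → b ≤ a → (a <ᵇ b) ≡ false
  <ᵇ-false a b b≤a with a <ᵇ b in e
  ... | false = refl
  ... | true = ⊥-elim (ℕP.<⇒≱ (ℕP.<ᵇ⇒< a b (Equivalence.from T-≡ e)) b≤a)

  <ᵇ-true : ∀ a b → a < b → (a <ᵇ b) ≡ true
  <ᵇ-true a b a<b = Equivalence.to T-≡ (ℕP.<⇒<ᵇ a<b)

  𝟙-∧-falseˡ : ∀ a b → a ≡ false → 𝟙 (a ∧ b) ≡ 0
  𝟙-∧-falseˡ .false b refl = refl

  𝟙-∧-falseʳ : ∀ a b → b ≡ false → 𝟙 (a ∧ b) ≡ 0
  𝟙-∧-falseʳ false b e = refl
  𝟙-∧-falseʳ true .false refl = refl

  isInversion-fromℕ-row : ∀ {m} (τ : Vec (Fin (suc m)) (suc m)) j → isInversion τ (Fin.fromℕ m) j ≡ 0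
  isInversion-fromℕ-row {m} τ j = 𝟙-∧-falseˡ _ _ (<ᵇ-false (toℕ (Fin.fromℕ m)) (toℕ j)
     (subst (toℕ j ≤_) (sym (toℕ-fromℕ m)) (ℕP.≤-pred (toℕ<n j))))

  inversions-addFixedPoint : ∀ {m} (σ : Vec (Fin m) m) → inversions (addFixedPoint σ) ≡ inversions σ
  inversions-addFixedPoint {m} σ = begin
    inversions τ ≡⟨ inversions-sumFin τ ⟩
    sumFin (suc m) (λ i → sumFin (suc m) (isInversion τ i)) ≡⟨ sumFin-inject₁-fromℕ m (λ i → sumFin (suc m) (isInversion τ i)) ⟩
    sumFin m (λ x → sumFin (suc m) (isInversion τ (inject₁ x))) + sumFin (suc m) (isInversion τ (Fin.fromℕ m))
       ≡⟨ cong₂ _+_ (sumFin-cong m row) (trans (sumFin-cong (suc m) (isInversion-fromℕ-row τ)) (sumFin-0 (suc m))) ⟩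
    sumFin m (λ x → sumFin m (isInversion σ x)) + 0 ≡⟨ ℕP.+-identityʳ _ ⟩
    sumFin m (λ x → sumFin m (isInversion σ x)) ≡⟨ sym (inversions-sumFin σ) ⟩
    inversions σ ∎
    where
    open ≡-Reasoning
    τ : Vec (Fin (suc m)) (suc m)
    τ = addFixedPoint σ
    cell : ∀ x y → isInversion τ (inject₁ x) (inject₁ y) ≡ isInversion σ x y
    cell x y = cong₂ (λ a b → 𝟙 (a ∧ b))
      (cong₂ _<ᵇ_ (toℕ-inject₁ x) (toℕ-inject₁ y))
      (cong₂ _<ᵇ_ (trans (cong toℕ (addFixedPoint-inject₁ σ y)) (toℕ-inject₁ _)) (trans (cong toℕ (addFixedPoint-inject₁ σ x)) (toℕ-inject₁ _)))
    lastcol : ∀ x → isInversion τ (inject₁ x) (Fin.fromℕ m) ≡ 0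
    lastcol x = 𝟙-∧-falseʳ _ _ (trans (cong₂ _<ᵇ_ (trans (cong toℕ (addFixedPoint-fromℕ σ)) (toℕ-fromℕ m)) (trans (cong toℕ (addFixedPoint-inject₁ σ x)) (toℕ-inject₁ _)))
                   (<ᵇ-false m (toℕ (lookup σ x)) (ℕP.<⇒≤ (toℕ<n _))))
    row : ∀ x → sumFin (suc m) (isInversion τ (inject₁ x)) ≡ sumFin m (isInversion σ x)
    row x = trans (sumFin-inject₁-fromℕ m (isInversion τ (inject₁ x))) (trans (cong₂ _+_ (sumFin-cong m (cell x)) (lastcol x)) (ℕP.+-identityʳ _))

  𝟙-∧-splitˡ : ∀ a b c → (T c → 𝟙 a + 𝟙 b ≡ 1) → 𝟙 (c ∧ a) + 𝟙 (c ∧ b) ≡ 𝟙 c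
  𝟙-∧-splitˡ a b false h = refl
  𝟙-∧-splitˡ a b true h = h _

  𝟙-∧-splitʳ : ∀ a b c → (T c → 𝟙 a + 𝟙 b ≡ 1) → 𝟙 (a ∧ c) + 𝟙 (b ∧ c) ≡ 𝟙 c
  𝟙-∧-splitʳ a b c h = trans (cong₂ _+_ (cong 𝟙 (∧-comm a c)) (cong 𝟙 (∧-comm b c))) (𝟙-∧-splitˡ a b c h)

  𝟙-<ᵇ-exclusive : ∀ a b → a ≢ b → 𝟙 (a <ᵇ b) + 𝟙 (b <ᵇ a) ≡ 1
  𝟙-<ᵇ-exclusive a b a≢b with ℕP.<-cmp a b
  ... | tri< a<b _ _ = cong₂ (λ u v → 𝟙 u + 𝟙 v) (<ᵇ-true a b a<b) (<ᵇ-false b a (ℕP.<⇒≤ a<b))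
  ... | tri≈ _ a≡b _ = ⊥-elim (a≢b a≡b)
  ... | tri> _ _ b<a = cong₂ (λ u v → 𝟙 u + 𝟙 v) (<ᵇ-false a b (ℕP.<⇒≤ b<a)) (<ᵇ-true b a b<a)

  𝟙-∧-true : ∀ a → 𝟙 (a ∧ true) ≡ 𝟙 a
  𝟙-∧-true false = refl
  𝟙-∧-true true = refl

  even-suc : ∀ n → even (suc n) ≡ not (even n)
  even-suc zero = refl
  even-suc (suc n) = trans (sym (not-involutive (even n))) (cong not (sym (even-suc n)))

  even-double-+ : ∀ k n → even (k + k + n) ≡ even n
  even-double-+ zero n = refl
  even-double-+ (suc k) n = trans (cong even (solve 2 (λ k n → (con 1 :+ k) :+ (con 1 :+ k) :+ n := con 2 :+ (k :+ k :+ n)) refl k n))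
    (even-double-+ k n)
    where open +-*-Solver

  -- Counting inversions row by row: the rows of τ = insertAfter σ j differ from those of σ only
  -- in the pairs involving j or the new point, and these corrections add up to an odd number.
  module InversionsOfInsertAfter {m} (σ : Vec (Fin m) m) (j : Fin m) (perm : IsPermutation σ) where

    τ : Vec (Fin (suc m)) (suc m)
    τ = insertAfter σ j

    σ̂ τ̂ : Fin m → ℕ
    σ̂ x = toℕ (lookup σ x)
    τ̂ x = toℕ (lookup τ (inject₁ x))

    ĵ P : ℕ
    ĵ = toℕ j
    P = σ̂ j

    τ̂-self : τ̂ j ≡ m
    τ̂-self = trans (cong toℕ (insertAfter-self σ j)) (toℕ-fromℕ m)

    τ̂-other : ∀ {x} → x ≢ j → τ̂ x ≡ σ̂ x
    τ̂-other x≢j = trans (cong toℕ (insertAfter-inject₁ σ j x≢j)) (toℕ-inject₁ _)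

    σ̂<m : ∀ x → σ̂ x < m
    σ̂<m x = toℕ<n (lookup σ x)

    ĵ<ĵ-false : (ĵ <ᵇ ĵ) ≡ false
    ĵ<ĵ-false = <ᵇ-false ĵ ĵ ℕP.≤-refl

    rowσ rowτ newColumn intoJ orderedIntoJ : Fin m → ℕ
    rowσ x = sumFin m (isInversion σ x)
    rowτ x = sumFin m (λ y → 𝟙 ((toℕ x <ᵇ toℕ y) ∧ (τ̂ y <ᵇ τ̂ x)))
    newColumn x = 𝟙 (P <ᵇ τ̂ x)
    intoJ x = isInversion σ x j
    orderedIntoJ x = 𝟙 ((toℕ x <ᵇ ĵ) ∧ (σ̂ x <ᵇ P))

    inversions-τ : inversions τ ≡ sumFin m rowτ + sumFin m newColumn
    inversions-τ = begin
      inversions τ                                                       ≡⟨ inversions-sumFin τ ⟩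
      sumFin (suc m) (λ i → sumFin (suc m) (isInversion τ i))            ≡⟨ sumFin-inject₁-fromℕ m (λ i → sumFin (suc m) (isInversion τ i)) ⟩
      sumFin m (λ x → sumFin (suc m) (isInversion τ (inject₁ x))) + sumFin (suc m) (isInversion τ (Fin.fromℕ m))
        ≡⟨ cong₂ _+_ (sumFin-cong m row) (trans (sumFin-cong (suc m) (isInversion-fromℕ-row τ)) (sumFin-0 (suc m))) ⟩
      sumFin m (λ x → rowτ x + newColumn x) + 0                          ≡⟨ ℕP.+-identityʳ _ ⟩
      sumFin m (λ x → rowτ x + newColumn x)                              ≡⟨ sumFin-+ m rowτ newColumn ⟩
      sumFin m rowτ + sumFin m newColumn                                 ∎
      where
      open ≡-Reasoning
      cell : ∀ x y → isInversion τ (inject₁ x) (inject₁ y) ≡ 𝟙 ((toℕ x <ᵇ toℕ y) ∧ (τ̂ y <ᵇ τ̂ x))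
      cell x y = cong (λ a → 𝟙 (a ∧ (τ̂ y <ᵇ τ̂ x))) (cong₂ _<ᵇ_ (toℕ-inject₁ x) (toℕ-inject₁ y))
      newCell : ∀ x → isInversion τ (inject₁ x) (Fin.fromℕ m) ≡ newColumn x
      newCell x = cong₂ (λ a b → 𝟙 (a ∧ b))
        (trans (cong₂ _<ᵇ_ (toℕ-inject₁ x) (toℕ-fromℕ m)) (<ᵇ-true _ _ (toℕ<n x)))
        (cong (_<ᵇ τ̂ x) (trans (cong toℕ (insertAfter-fromℕ σ j)) (toℕ-inject₁ _)))
      row : ∀ x → sumFin (suc m) (isInversion τ (inject₁ x)) ≡ rowτ x + newColumn x
      row x = trans (sumFin-inject₁-fromℕ m (isInversion τ (inject₁ x))) (cong₂ _+_ (sumFin-cong m (cell x)) (newCell x))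

    newColumn-total : sumFin m newColumn ≡ (m ∸ suc P) + 1
    newColumn-total = begin
      sumFin m newColumn                              ≡⟨ ℕP.+-identityʳ _ ⟨
      sumFin m newColumn + 0                          ≡⟨ cong (λ b → sumFin m newColumn + 𝟙 b) (<ᵇ-false P P ℕP.≤-refl) ⟨
      sumFin m newColumn + 𝟙 (P <ᵇ P)                 ≡⟨ sumFin-agreeOff m newColumn (λ x → 𝟙 (P <ᵇ σ̂ x)) j
                                                           (λ y y≢j → cong (λ v → 𝟙 (P <ᵇ v)) (τ̂-other y≢j)) ⟩
      sumFin m (λ x → 𝟙 (P <ᵇ σ̂ x)) + newColumn j     ≡⟨ cong₂ _+_ (sumFin-permute m σ perm (λ v → 𝟙 (P <ᵇ toℕ v)))
                                                                    (cong (λ v → 𝟙 (P <ᵇ v)) τ̂-self) ⟩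
      sumFin m (λ v → 𝟙 (P <ᵇ toℕ v)) + 𝟙 (P <ᵇ m)    ≡⟨ cong₂ _+_ (sumFin-> m P) (cong 𝟙 (<ᵇ-true _ _ (σ̂<m j))) ⟩
      (m ∸ suc P) + 1                                 ∎
      where open ≡-Reasoning

    below-j⇒≢j : ∀ {x} → toℕ x < ĵ → x ≢ j
    below-j⇒≢j x<j refl = ℕP.<-irrefl refl x<j

    rowτ-j : rowτ j ≡ m ∸ suc ĵ
    rowτ-j = trans (sumFin-cong m cell) (sumFin-> m ĵ)
      where
      cell : ∀ y → 𝟙 ((ĵ <ᵇ toℕ y) ∧ (τ̂ y <ᵇ τ̂ j)) ≡ 𝟙 (ĵ <ᵇ toℕ y)
      cell y with y FinP.≟ j
      ... | yes refl = trans (𝟙-∧-falseˡ _ _ ĵ<ĵ-false) (cong 𝟙 (sym ĵ<ĵ-false))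
      ... | no y≢j   = trans (cong (λ b → 𝟙 ((ĵ <ᵇ toℕ y) ∧ b))
                         (trans (cong₂ _<ᵇ_ (τ̂-other y≢j) τ̂-self) (<ᵇ-true _ _ (σ̂<m y)))) (𝟙-∧-true _)

    rowτ-other : ∀ {x} → x ≢ j → rowτ x + intoJ x ≡ rowσ x
    rowτ-other {x} x≢j = trans (sumFin-agreeOff m f (isInversion σ x) j agree) (trans (cong (rowσ x +_) f-j) (ℕP.+-identityʳ _))
      where
      f : Fin m → ℕ
      f y = 𝟙 ((toℕ x <ᵇ toℕ y) ∧ (τ̂ y <ᵇ τ̂ x))
      agree : ∀ y → y ≢ j → f y ≡ isInversion σ x y
      agree y y≢j = cong (λ c → 𝟙 ((toℕ x <ᵇ toℕ y) ∧ c)) (cong₂ _<ᵇ_ (τ̂-other y≢j) (τ̂-other x≢j))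
      f-j : f j ≡ 0
      f-j = 𝟙-∧-falseʳ _ _ (trans (cong₂ _<ᵇ_ τ̂-self (τ̂-other x≢j)) (<ᵇ-false m (σ̂ x) (ℕP.<⇒≤ (σ̂<m x))))

    lost gained : Fin m → ℕ
    lost x = if x ≡ᶠ j then rowσ j else intoJ x
    gained x = if x ≡ᶠ j then m ∸ suc ĵ else 0

    rowτ-balance : ∀ x → rowτ x + lost x ≡ rowσ x + gained x
    rowτ-balance x with x FinP.≟ j
    ... | yes refl = begin
      rowτ j + lost j           ≡⟨ cong (λ c → rowτ j + (if c then rowσ j else intoJ j)) (≡⇒≡ᶠ-true {i = j} refl) ⟩
      rowτ j + rowσ j           ≡⟨ cong (_+ rowσ j) rowτ-j ⟩
      m ∸ suc ĵ + rowσ j        ≡⟨ ℕP.+-comm _ (rowσ j) ⟩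
      rowσ j + (m ∸ suc ĵ)      ≡⟨ cong (λ c → rowσ j + (if c then m ∸ suc ĵ else 0)) (≡⇒≡ᶠ-true {i = j} refl) ⟨
      rowσ j + gained j         ∎
      where open ≡-Reasoning
    ... | no x≢j = begin
      rowτ x + lost x           ≡⟨ cong (λ c → rowτ x + (if c then rowσ j else intoJ x)) (≢⇒≡ᶠ-false x≢j) ⟩
      rowτ x + intoJ x          ≡⟨ rowτ-other x≢j ⟩
      rowσ x                    ≡⟨ ℕP.+-identityʳ _ ⟨
      rowσ x + 0                ≡⟨ cong (λ c → rowσ x + (if c then m ∸ suc ĵ else 0)) (≢⇒≡ᶠ-false x≢j) ⟨
      rowσ x + gained x         ∎
      where open ≡-Reasoning

    rowsτ-total : sumFin m rowτ + sumFin m lost ≡ inversions σ + (m ∸ suc ĵ)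
    rowsτ-total = begin
      sumFin m rowτ + sumFin m lost         ≡⟨ sumFin-+ m rowτ lost ⟨
      sumFin m (λ x → rowτ x + lost x)      ≡⟨ sumFin-cong m rowτ-balance ⟩
      sumFin m (λ x → rowσ x + gained x)    ≡⟨ sumFin-+ m rowσ gained ⟩
      sumFin m rowσ + sumFin m gained       ≡⟨ cong₂ _+_ (sym (inversions-sumFin σ)) (sumFin-δ m j (m ∸ suc ĵ)) ⟩
      inversions σ + (m ∸ suc ĵ)            ∎
      where open ≡-Reasoning

    lost-total : sumFin m lost ≡ sumFin m intoJ + rowσ j
    lost-total = begin
      sumFin m lost                   ≡⟨ ℕP.+-identityʳ _ ⟨
      sumFin m lost + 0               ≡⟨ cong (sumFin m lost +_) (𝟙-∧-falseˡ _ _ ĵ<ĵ-false) ⟨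
      sumFin m lost + intoJ j         ≡⟨ sumFin-agreeOff m lost intoJ j (λ y y≢j → cong (λ c → if c then rowσ j else intoJ y) (≢⇒≡ᶠ-false y≢j)) ⟩
      sumFin m intoJ + lost j         ≡⟨ cong (λ c → sumFin m intoJ + (if c then rowσ j else intoJ j)) (≡⇒≡ᶠ-true {i = j} refl) ⟩
      sumFin m intoJ + rowσ j         ∎
      where open ≡-Reasoning

    intoJ-orderedIntoJ-total : sumFin m intoJ + sumFin m orderedIntoJ ≡ ĵ
    intoJ-orderedIntoJ-total = trans (sym (sumFin-+ m intoJ orderedIntoJ)) (trans (sumFin-cong m split) (sumFin-< m ĵ (ℕP.<⇒≤ (toℕ<n j))))
      where
      split : ∀ x → intoJ x + orderedIntoJ x ≡ 𝟙 (toℕ x <ᵇ ĵ)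
      split x = 𝟙-∧-splitˡ (P <ᵇ σ̂ x) (σ̂ x <ᵇ P) (toℕ x <ᵇ ĵ) λ x<j →
        𝟙-<ᵇ-exclusive P (σ̂ x) λ P≡σ̂x → below-j⇒≢j (ℕP.<ᵇ⇒< _ _ x<j) (perm (toℕ-injective (sym P≡σ̂x)))

    rowσ-j-orderedIntoJ-total : rowσ j + sumFin m orderedIntoJ ≡ P
    rowσ-j-orderedIntoJ-total = trans (sym (sumFin-+ m (isInversion σ j) orderedIntoJ)) (trans (sumFin-cong m split)
        (trans (sumFin-permute m σ perm (λ v → 𝟙 (toℕ v <ᵇ P))) (sumFin-< m P (ℕP.<⇒≤ (σ̂<m j)))))
      where
      split : ∀ x → isInversion σ j x + orderedIntoJ x ≡ 𝟙 (σ̂ x <ᵇ P)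
      split x = 𝟙-∧-splitʳ (ĵ <ᵇ toℕ x) (toℕ x <ᵇ ĵ) (σ̂ x <ᵇ P) λ σx<P →
        𝟙-<ᵇ-exclusive ĵ (toℕ x) λ ĵ≡x → ℕP.<-irrefl (cong σ̂ (sym (toℕ-injective ĵ≡x))) (ℕP.<ᵇ⇒< _ _ σx<P)

    correction : ℕ
    correction = rowσ j + sumFin m intoJ + sumFin m orderedIntoJ

    inversions-insertAfter : correction + correction + suc (inversions τ) ≡ inversions σ + m + m
    inversions-insertAfter = begin
      K + K + suc (inversions τ)                ≡⟨ cong (λ z → K + K + suc z) inversions-τ ⟩
      K + K + suc (R + L)                       ≡⟨ solve 5 (λ R L A B C → (A :+ B :+ C) :+ (A :+ B :+ C) :+ (con 1 :+ (R :+ L))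
                                                     := (R :+ (B :+ A)) :+ L :+ (B :+ C) :+ (A :+ C) :+ con 1) refl R L A B C ⟩
      R + (B + A) + L + (B + C) + (A + C) + 1   ≡⟨ cong₂ (λ u v → u + v + (B + C) + (A + C) + 1)
                                                     (trans (cong (R +_) (sym lost-total)) rowsτ-total) newColumn-total ⟩
      inversions σ + Y + (X + 1) + (B + C) + (A + C) + 1
                                                ≡⟨ cong₂ (λ u v → inversions σ + Y + (X + 1) + u + v + 1)
                                                     intoJ-orderedIntoJ-total rowσ-j-orderedIntoJ-total ⟩
      inversions σ + Y + (X + 1) + ĵ + P + 1    ≡⟨ solve 5 (λ i y x j p → (i :+ y) :+ (x :+ con 1) :+ j :+ p :+ con 1
                                                     := i :+ (y :+ (con 1 :+ j)) :+ (x :+ (con 1 :+ p))) refl (inversions σ) Y X ĵ P ⟩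
      inversions σ + (Y + suc ĵ) + (X + suc P)  ≡⟨ cong₂ (λ u v → inversions σ + u + v) (ℕP.m∸n+n≡m (toℕ<n j)) (ℕP.m∸n+n≡m (σ̂<m j)) ⟩
      inversions σ + m + m                      ∎
      where
      open ≡-Reasoning
      open +-*-Solver
      R L A B C K X Y : ℕ
      R = sumFin m rowτ
      L = sumFin m newColumn
      A = rowσ j
      B = sumFin m intoJ
      C = sumFin m orderedIntoJ
      K = correction
      X = m ∸ suc P
      Y = m ∸ suc ĵ

    even-inversions-insertAfter : even (inversions τ) ≡ not (even (inversions σ))
    even-inversions-insertAfter = begin
      even (inversions τ)                                  ≡⟨ not-involutive _ ⟨
      not (not (even (inversions τ)))                      ≡⟨ cong not (even-suc (inversions τ)) ⟨
      not (even (suc (inversions τ)))                      ≡⟨ cong not (even-double-+ correction (suc (inversions τ))) ⟨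
      not (even (correction + correction + suc (inversions τ))) ≡⟨ cong (not ∘ even) inversions-insertAfter ⟩
      not (even (inversions σ + m + m))                    ≡⟨ cong (not ∘ even) (ℕP.+-comm (inversions σ + m) m) ⟩
      not (even (m + (inversions σ + m)))                  ≡⟨ cong (λ z → not (even (m + z))) (ℕP.+-comm (inversions σ) m) ⟩
      not (even (m + (m + inversions σ)))                  ≡⟨ cong (not ∘ even) (ℕP.+-assoc m m (inversions σ)) ⟨
      not (even (m + m + inversions σ))                    ≡⟨ cong not (even-double-+ m (inversions σ)) ⟩
      not (even (inversions σ))                            ∎
      where open ≡-Reasoning

  -- Enumerating the permutations of Fin (suc m)

  lookup-extensionality : ∀ {A : Set} {n} (u v : Vec A n) → (∀ k → lookup u k ≡ lookup v k) → u ≡ v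
  lookup-extensionality u v h = trans (sym (tabulate∘lookup u)) (trans (tabulate-cong h) (tabulate∘lookup v))

  unique-concatMap : ∀ {A B : Set} (g : A → List B) {xs} → Unique xs → (∀ x → Unique (g x)) →
                     (∀ {x y z} → z ∈ g x → z ∈ g y → x ≡ y) → Unique (concatMap g xs)
  unique-concatMap g {[]}     _            ug disjoint = []
  unique-concatMap g {x ∷ xs} (x∉xs ∷ uxs) ug disjoint = UniqueP.++⁺ (ug x) (unique-concatMap g uxs ug disjoint) apart
    where
    apart : ∀ {v} → ¬ (v ∈ g x × v ∈ concatMap g xs)
    apart (v∈gx , v∈rest) with ∈-concat⁻′ (map g xs) v∈rest
    ... | ys , v∈ys , ys∈ with ∈-map⁻ g ys∈
    ... | y , y∈xs , refl = All¬⇒¬Any x∉xs (subst (_∈ xs) (sym (disjoint v∈gx v∈ys)) y∈xs)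

  finVecs-complete : ∀ m n (v : Vec (Fin m) n) → v ∈ finVecs m n
  finVecs-complete m zero    Vec.[]        = here refl
  finVecs-complete m (suc n) (x Vec.∷ v) =
    ∈-concat⁺′ (∈-map⁺ (x Vec.∷_) (finVecs-complete m n v)) (∈-map⁺ (λ x → map (x Vec.∷_) (finVecs m n)) (∈-allFin x))

  finVecs-unique : ∀ m n → Unique (finVecs m n)
  finVecs-unique m zero    = [] ∷ []
  finVecs-unique m (suc n) = unique-concatMap (λ x → map (x Vec.∷_) (finVecs m n)) (UniqueP.allFin⁺ m)
    (λ x → UniqueP.map⁺ (proj₂ ∘ ∷-injective) (finVecs-unique m n)) sameHead
    where
    sameHead : ∀ {x y z} → z ∈ map (x Vec.∷_) (finVecs m n) → z ∈ map (y Vec.∷_) (finVecs m n) → x ≡ y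
    sameHead zx zy with ∈-map⁻ _ zx | ∈-map⁻ _ zy
    ... | _ , _ , refl | _ , _ , e = proj₁ (∷-injective e)

  perms-unique : ∀ m → Unique (perms m)
  perms-unique m = UniqueP.filter⁺ (T? ∘ isPerm) (finVecs-unique m m)

  permutation⇒∈perms : ∀ {m} (σ : Vec (Fin m) m) → IsPermutation σ → σ ∈ perms m
  permutation⇒∈perms {m} σ perm = ∈-filter⁺ (T? ∘ isPerm) (finVecs-complete m m σ) (permutation⇒isPerm σ perm)

  ∈perms⇒permutation : ∀ {m} {σ : Vec (Fin m) m} → σ ∈ perms m → IsPermutation σ
  ∈perms⇒permutation {m} {σ} σ∈ = isPerm⇒permutation σ (proj₂ (∈-filter⁻ (T? ∘ isPerm) {xs = finVecs m m} σ∈))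

  extensions : ∀ {m} → Vec (Fin m) m → List (Vec (Fin (suc m)) (suc m))
  extensions {m} σ = addFixedPoint σ ∷ map (insertAfter σ) (allFin m)

  -- Deleting the new point from its cycle: the inverse of both kinds of extension.
  removeNew : ∀ {m} → Vec (Fin (suc m)) (suc m) → Fin m → Fin (suc m)
  removeNew {m} τ x = if lookup τ (inject₁ x) ≡ᶠ Fin.fromℕ m then lookup τ (Fin.fromℕ m) else lookup τ (inject₁ x)

  module _ {m} (τ : Vec (Fin (suc m)) (suc m)) where

    removeNew-≢ : ∀ {x} → lookup τ (inject₁ x) ≢ Fin.fromℕ m → removeNew τ x ≡ lookup τ (inject₁ x)
    removeNew-≢ {x} ne = cong (λ c → if c then lookup τ (Fin.fromℕ m) else lookup τ (inject₁ x)) (≢⇒≡ᶠ-false ne)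

    removeNew-≡ : ∀ {x} → lookup τ (inject₁ x) ≡ Fin.fromℕ m → removeNew τ x ≡ lookup τ (Fin.fromℕ m)
    removeNew-≡ {x} e = cong (λ c → if c then lookup τ (Fin.fromℕ m) else lookup τ (inject₁ x)) (≡⇒≡ᶠ-true e)

    removeNew-cases : ∀ x → (lookup τ (inject₁ x) ≡ Fin.fromℕ m × removeNew τ x ≡ lookup τ (Fin.fromℕ m))
                          ⊎ (lookup τ (inject₁ x) ≢ Fin.fromℕ m × removeNew τ x ≡ lookup τ (inject₁ x))
    removeNew-cases x with lookup τ (inject₁ x) FinP.≟ Fin.fromℕ m
    ... | yes τx≡new = inj₁ (τx≡new , removeNew-≡ τx≡new)
    ... | no  τx≢new = inj₂ (τx≢new , removeNew-≢ τx≢new)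

  extensions-removeNew : ∀ {m} (σ : Vec (Fin m) m) {τ} → τ ∈ extensions σ → ∀ x → removeNew τ x ≡ inject₁ (lookup σ x)
  extensions-removeNew σ (here refl) x =
    trans (removeNew-≢ (addFixedPoint σ) (λ e → inject₁≢fromℕ _ (trans (sym (addFixedPoint-inject₁ σ x)) e))) (addFixedPoint-inject₁ σ x)
  extensions-removeNew σ (there τ∈) x with ∈-map⁻ (insertAfter σ) τ∈
  ... | j , _ , refl with insertAfter-cases σ j x
  ...   | inj₁ (refl , e) = trans (removeNew-≡ (insertAfter σ j) e) (insertAfter-fromℕ σ j)
  ...   | inj₂ (_ , e)    = trans (removeNew-≢ (insertAfter σ j) (λ e′ → inject₁≢fromℕ _ (trans (sym e) e′))) e

  extensions-disjoint : ∀ {m} {σ σ′ : Vec (Fin m) m} {τ} → τ ∈ extensions σ → τ ∈ extensions σ′ → σ ≡ σ′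
  extensions-disjoint {σ = σ} {σ′} τ∈ τ∈′ = lookup-extensionality σ σ′ λ x →
    inject₁-injective (trans (sym (extensions-removeNew σ τ∈ x)) (extensions-removeNew σ′ τ∈′ x))

  extensions-unique : ∀ {m} (σ : Vec (Fin m) m) → Unique (extensions σ)
  extensions-unique {m} σ = ¬Any⇒All¬ _ fixed∉inserted ∷ UniqueP.map⁺ insertAfter-injective (UniqueP.allFin⁺ m)
    where
    fixed∉inserted : ¬ Any (addFixedPoint σ ≡_) (map (insertAfter σ) (allFin m))
    fixed∉inserted a with ∈-map⁻ (insertAfter σ) a
    ... | j , _ , e = inject₁≢fromℕ _ (sym (trans (sym (addFixedPoint-fromℕ σ))
                        (trans (cong (λ v → lookup v (Fin.fromℕ m)) e) (insertAfter-fromℕ σ j))))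
    insertAfter-injective : ∀ {a b} → insertAfter σ a ≡ insertAfter σ b → a ≡ b
    insertAfter-injective {a} {b} e with a FinP.≟ b
    ... | yes a≡b = a≡b
    ... | no  a≢b = ⊥-elim (inject₁≢fromℕ _ (sym (trans (sym (insertAfter-self σ a))
                      (trans (cong (λ v → lookup v (inject₁ a)) e) (insertAfter-inject₁ σ b a≢b)))))

  extensions-permutation : ∀ {m} (σ : Vec (Fin m) m) → IsPermutation σ → ∀ {τ} → τ ∈ extensions σ → IsPermutation τ
  extensions-permutation σ perm (here refl) = addFixedPoint-permutation σ perm
  extensions-permutation σ perm (there τ∈) with ∈-map⁻ (insertAfter σ) τ∈
  ... | j , _ , refl = insertAfter-permutation σ j perm

  module Restriction {m} (τ : Vec (Fin (suc m)) (suc m)) (τ-perm : IsPermutation τ) where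

    removeNew-old : ∀ x → m ≢ toℕ (removeNew τ x)
    removeNew-old x m≡ with removeNew-cases τ x | toℕ-injective {j = Fin.fromℕ m} (trans (sym m≡) (sym (toℕ-fromℕ m)))
    ... | inj₁ (τx≡new , e) | removed≡new = inject₁≢fromℕ x (sym (τ-perm (trans (trans (sym e) removed≡new) (sym τx≡new))))
    ... | inj₂ (τx≢new , e) | removed≡new = τx≢new (trans (sym e) removed≡new)

    σ : Vec (Fin m) m
    σ = Vec.tabulate λ x → lower₁ (removeNew τ x) (removeNew-old x)

    inject₁-σ : ∀ x → inject₁ (lookup σ x) ≡ removeNew τ x
    inject₁-σ x = trans (cong inject₁ (lookup∘tabulate _ x)) (inject₁-lower₁ (removeNew τ x) _)

    removeNew-cong : ∀ {x y} → lookup σ x ≡ lookup σ y → removeNew τ x ≡ removeNew τ y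
    removeNew-cong {x} {y} e = trans (sym (inject₁-σ x)) (trans (cong inject₁ e) (inject₁-σ y))

    σ-permutation : IsPermutation σ
    σ-permutation {x} {y} e with removeNew-cases τ x | removeNew-cases τ y
    ... | inj₁ (τx≡new , _) | inj₁ (τy≡new , _) = inject₁-injective (τ-perm (trans τx≡new (sym τy≡new)))
    ... | inj₁ (_ , wx) | inj₂ (_ , wy) = ⊥-elim (inject₁≢fromℕ y (sym (τ-perm (trans (sym wx) (trans (removeNew-cong e) wy)))))
    ... | inj₂ (_ , wx) | inj₁ (_ , wy) = ⊥-elim (inject₁≢fromℕ x (τ-perm (trans (sym wx) (trans (removeNew-cong e) wy))))
    ... | inj₂ (_ , wx) | inj₂ (_ , wy) = inject₁-injective (τ-perm (trans (sym wx) (trans (removeNew-cong e) wy)))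

    new-fixed⇒addFixedPoint : lookup τ (Fin.fromℕ m) ≡ Fin.fromℕ m → τ ≡ addFixedPoint σ
    new-fixed⇒addFixedPoint τnew≡new = lookup-extensionality τ (addFixedPoint σ) λ k → agree k (view k)
      where
      agree : ∀ k → View k → lookup τ k ≡ lookup (addFixedPoint σ) k
      agree .(inject₁ x) (‵inject₁ x) with removeNew-cases τ x
      ... | inj₁ (τx≡new , _) = ⊥-elim (inject₁≢fromℕ x (τ-perm (trans τx≡new (sym τnew≡new))))
      ... | inj₂ (_ , w) = sym (trans (addFixedPoint-inject₁ σ x) (trans (inject₁-σ x) w))
      agree .(Fin.fromℕ m) ‵fromℕ = trans τnew≡new (sym (addFixedPoint-fromℕ σ))

    new-after⇒insertAfter : ∀ j → lookup τ (inject₁ j) ≡ Fin.fromℕ m → τ ≡ insertAfter σ j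
    new-after⇒insertAfter j τj≡new = lookup-extensionality τ (insertAfter σ j) λ k → agree k (view k)
      where
      agree : ∀ k → View k → lookup τ k ≡ lookup (insertAfter σ j) k
      agree .(inject₁ x) (‵inject₁ x) with x FinP.≟ j
      ... | yes refl = trans τj≡new (sym (insertAfter-self σ j))
      ... | no x≢j with removeNew-cases τ x
      ...   | inj₁ (τx≡new , _) = ⊥-elim (x≢j (inject₁-injective (τ-perm (trans τx≡new (sym τj≡new)))))
      ...   | inj₂ (_ , w) = sym (trans (insertAfter-inject₁ σ j x≢j) (trans (inject₁-σ x) w))
      agree .(Fin.fromℕ m) ‵fromℕ = sym (trans (insertAfter-fromℕ σ j) (trans (inject₁-σ j) (removeNew-≡ τ τj≡new)))

    ∈extensions : τ ∈ extensions σ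
    ∈extensions with permutation-surjective τ τ-perm (Fin.fromℕ m)
    ... | k , τk≡new = from-preimage k (view k) τk≡new
      where
      from-preimage : ∀ k → View k → lookup τ k ≡ Fin.fromℕ m → τ ∈ extensions σ
      from-preimage .(Fin.fromℕ m) ‵fromℕ e = here (new-fixed⇒addFixedPoint e)
      from-preimage .(inject₁ j) (‵inject₁ j) e =
        there (subst (_∈ map (insertAfter σ) (allFin m)) (sym (new-after⇒insertAfter j e)) (∈-map⁺ (insertAfter σ) (∈-allFin j)))

  perms-suc-↭ : ∀ m → perms (suc m) ↭ concatMap extensions (perms m)
  perms-suc-↭ m = unique-⊆-⊇⇒↭ (perms-unique (suc m))
    (unique-concatMap extensions (perms-unique m) extensions-unique extensions-disjoint) restrict extend
    where
    restrict : ∀ {τ} → τ ∈ perms (suc m) → τ ∈ concatMap extensions (perms m)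
    restrict {τ} τ∈ = let open Restriction τ (∈perms⇒permutation τ∈) in
      ∈-concat⁺′ ∈extensions (∈-map⁺ extensions (permutation⇒∈perms σ σ-permutation))
    extend : ∀ {τ} → τ ∈ concatMap extensions (perms m) → τ ∈ perms (suc m)
    extend {τ} τ∈ with ∈-concat⁻′ (map extensions (perms m)) τ∈
    ... | ys , τ∈ys , ys∈ with ∈-map⁻ extensions ys∈
    ... | σ , σ∈ , refl = permutation⇒∈perms τ (extensions-permutation σ (∈perms⇒permutation σ∈) τ∈ys)

  -- Partitions as multiplicity vectors

  occurrences : ℕ → List ℕ → ℕ
  occurrences x []       = 0
  occurrences x (y ∷ ys) = (if x ≡ᵇ y then 1 else 0) + occurrences x ys

  multiplicities : ℕ → (r : ℕ) → List ℕ → Vec ℕ r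
  multiplicities v zero    l = Vec.[]
  multiplicities v (suc r) l = occurrences v l Vec.∷ multiplicities (suc v) r l

  expand : ∀ {r} → ℕ → Vec ℕ r → List ℕ
  expand v Vec.[]       = []
  expand v (c Vec.∷ cs) = replicate c v ++ expand (suc v) cs

  data SortedFrom : ℕ → List ℕ → Set where
    []  : ∀ {b} → SortedFrom b []
    _∷_ : ∀ {b x l} → b ≤ x → SortedFrom x l → SortedFrom b (x ∷ l)

  ≡ᵇ-refl : ∀ n → (n ≡ᵇ n) ≡ true
  ≡ᵇ-refl n = Equivalence.to T-≡ (ℕP.≡⇒≡ᵇ n n refl)

  ≢⇒≡ᵇ-false : ∀ {m n} → m ≢ n → (m ≡ᵇ n) ≡ false
  ≢⇒≡ᵇ-false {m} {n} m≢n with m ≡ᵇ n in e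
  ... | false = refl
  ... | true  = ⊥-elim (m≢n (ℕP.≡ᵇ⇒≡ m n (Equivalence.from T-≡ e)))

  length-expand : ∀ {r} v (cs : Vec ℕ r) → length (expand v cs) ≡ Vec.sum cs
  length-expand v Vec.[]       = refl
  length-expand v (c Vec.∷ cs) =
    trans (ListP.length-++ (replicate c v)) (cong₂ _+_ (ListP.length-replicate c) (length-expand (suc v) cs))

  sum-replicate : ∀ c v → ℕL.sum (replicate c v) ≡ c * v
  sum-replicate zero    v = refl
  sum-replicate (suc c) v = cong (v +_) (sum-replicate c v)

  sum-expand : ∀ {r} v (cs : Vec ℕ r) → ℕL.sum (expand v cs) ≡ wsumFrom v cs
  sum-expand v Vec.[]       = refl
  sum-expand v (c Vec.∷ cs) = trans (ℕLP.sum-++ (replicate c v) _)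
    (cong₂ _+_ (trans (sum-replicate c v) (ℕP.*-comm c v)) (sum-expand (suc v) cs))

  wsumFrom-suc : ∀ {r} v (cs : Vec ℕ r) → wsumFrom (suc v) cs ≡ wsumFrom v cs + Vec.sum cs
  wsumFrom-suc v Vec.[]       = refl
  wsumFrom-suc v (c Vec.∷ cs) = trans (cong (suc v * c +_) (wsumFrom-suc (suc v) cs))
    (solve 4 (λ v c w s → (con 1 :+ v) :* c :+ (w :+ s) := v :* c :+ w :+ (c :+ s)) refl v c (wsumFrom (suc v) cs) (Vec.sum cs))
    where open +-*-Solver

  occurrences-++ : ∀ x l₁ l₂ → occurrences x (l₁ ++ l₂) ≡ occurrences x l₁ + occurrences x l₂
  occurrences-++ x []       l₂ = refl
  occurrences-++ x (y ∷ l₁) l₂ =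
    trans (cong ((if x ≡ᵇ y then 1 else 0) +_) (occurrences-++ x l₁ l₂)) (sym (ℕP.+-assoc (if x ≡ᵇ y then 1 else 0) _ _))

  occurrences-replicate : ∀ c v → occurrences v (replicate c v) ≡ c
  occurrences-replicate zero    v = refl
  occurrences-replicate (suc c) v = cong₂ (λ b n → (if b then 1 else 0) + n) (≡ᵇ-refl v) (occurrences-replicate c v)

  occurrences-absent : ∀ x l → (∀ y → y ∈ l → x ≢ y) → occurrences x l ≡ 0
  occurrences-absent x []      h = refl
  occurrences-absent x (y ∷ l) h =
    cong₂ (λ b n → (if b then 1 else 0) + n) (≢⇒≡ᵇ-false (h y (here refl))) (occurrences-absent x l (λ z z∈ → h z (there z∈)))

  occurrences≤length : ∀ v l → occurrences v l ≤ length l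
  occurrences≤length v []      = z≤n
  occurrences≤length v (y ∷ l) with v ≡ᵇ y
  ... | true  = s≤s (occurrences≤length v l)
  ... | false = ℕP.m≤n⇒m≤1+n (occurrences≤length v l)

  multiplicities-skip : ∀ r {w v} l → v < w → multiplicities w r (v ∷ l) ≡ multiplicities w r l
  multiplicities-skip zero    l v<w = refl
  multiplicities-skip (suc r) {w} {v} l v<w = cong₂ Vec._∷_
    (cong (λ b → (if b then 1 else 0) + occurrences w l) (≢⇒≡ᵇ-false (λ w≡v → ℕP.<-irrefl (sym w≡v) v<w)))
    (multiplicities-skip r l (ℕP.m<n⇒m<1+n v<w))

  multiplicities-skip-replicate : ∀ r {w} c {v} l → v < w → multiplicities w r (replicate c v ++ l) ≡ multiplicities w r l
  multiplicities-skip-replicate r zero    l v<w = refl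
  multiplicities-skip-replicate r (suc c) l v<w = trans (multiplicities-skip r _ v<w) (multiplicities-skip-replicate r c l v<w)

  multiplicities-bounded : ∀ r v l → ∀ {y} → y ∈ Vec.toList (multiplicities v r l) → y ≤ length l
  multiplicities-bounded (suc r) v l (here refl) = occurrences≤length v l
  multiplicities-bounded (suc r) v l (there y∈)  = multiplicities-bounded r (suc v) l y∈

  ∈-replicate : ∀ {c v y : ℕ} → y ∈ replicate c v → y ≡ v
  ∈-replicate {suc c} (here e)   = e
  ∈-replicate {suc c} (there y∈) = ∈-replicate {c} y∈

  ∈-expand-bounds : ∀ {r} v (cs : Vec ℕ r) → ∀ {y} → y ∈ expand v cs → v ≤ y × y < v + r
  ∈-expand-bounds {suc r} v (c Vec.∷ cs) {y} y∈ with ∈-++⁻ (replicate c v) y∈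
  ... | inj₁ y∈c = subst (λ z → v ≤ z × z < v + suc r) (sym (∈-replicate {c} y∈c)) (ℕP.≤-refl , ℕP.m<m+n v (s≤s z≤n))
  ... | inj₂ y∈cs with ∈-expand-bounds (suc v) cs y∈cs
  ...   | v<y , y<v+r = ℕP.<⇒≤ v<y , subst (y <_) (sym (ℕP.+-suc v r)) y<v+r

  multiplicities-expand : ∀ {r} v (cs : Vec ℕ r) → multiplicities v r (expand v cs) ≡ cs
  multiplicities-expand v Vec.[]       = refl
  multiplicities-expand v (c Vec.∷ cs) = cong₂ Vec._∷_
    (trans (occurrences-++ v (replicate c v) _) (trans (cong₂ _+_ (occurrences-replicate c v)
       (occurrences-absent v _ (λ y y∈ v≡y → ℕP.<-irrefl v≡y (proj₁ (∈-expand-bounds (suc v) cs y∈))))) (ℕP.+-identityʳ c)))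
    (trans (multiplicities-skip-replicate _ c _ (ℕP.n<1+n v)) (multiplicities-expand (suc v) cs))

  SortedFrom-weaken : ∀ {b b′ l} → b′ ≤ b → SortedFrom b l → SortedFrom b′ l
  SortedFrom-weaken b′≤b []          = []
  SortedFrom-weaken b′≤b (b≤x ∷ s) = ℕP.≤-trans b′≤b b≤x ∷ s

  SortedFrom-lowerBound : ∀ {b l} → SortedFrom b l → ∀ {y} → y ∈ l → b ≤ y
  SortedFrom-lowerBound (b≤x ∷ s) (here refl) = b≤x
  SortedFrom-lowerBound (b≤x ∷ s) (there y∈)  = ℕP.≤-trans b≤x (SortedFrom-lowerBound s y∈)

  SortedFrom-replicate : ∀ c v {l} → SortedFrom (suc v) l → SortedFrom v (replicate c v ++ l)
  SortedFrom-replicate zero    v s = SortedFrom-weaken (ℕP.n≤1+n v) s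
  SortedFrom-replicate (suc c) v s = ℕP.≤-refl ∷ SortedFrom-replicate c v s

  expand-sorted : ∀ {r} v (cs : Vec ℕ r) → SortedFrom v (expand v cs)
  expand-sorted v Vec.[]       = []
  expand-sorted v (c Vec.∷ cs) = SortedFrom-replicate c v (expand-sorted (suc v) cs)

  expand-multiplicities-skip : ∀ r {v x l} → v < x → SortedFrom x l →
    expand (suc v) (multiplicities (suc v) r (x ∷ l)) ≡ expand v (multiplicities v (suc r) (x ∷ l))
  expand-multiplicities-skip r {v} {x} {l} v<x s =
    cong (λ c → replicate c v ++ expand (suc v) (multiplicities (suc v) r (x ∷ l))) (sym v-absent)
    where
    v-absent : occurrences v (x ∷ l) ≡ 0
    v-absent = occurrences-absent v (x ∷ l) (λ y y∈ v≡y → ℕP.<-irrefl v≡y (ℕP.<-≤-trans v<x (SortedFrom-lowerBound (ℕP.≤-refl ∷ s) y∈)))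

  expand-multiplicities-head : ∀ r {v x l} → v ≡ x → l ≡ expand v (multiplicities v (suc r) l) →
    x ∷ l ≡ expand v (multiplicities v (suc r) (x ∷ l))
  expand-multiplicities-head r {v} {l = l} refl l≡ = begin
    v ∷ l                                                                   ≡⟨ cong (v ∷_) l≡ ⟩
    v ∷ replicate (occurrences v l) v ++ expand (suc v) (multiplicities (suc v) r l)
      ≡⟨ cong (λ w → v ∷ replicate (occurrences v l) v ++ expand (suc v) w) (multiplicities-skip r l (ℕP.n<1+n v)) ⟨
    replicate (1 + occurrences v l) v ++ expand (suc v) (multiplicities (suc v) r (v ∷ l))
      ≡⟨ cong (λ b → replicate ((if b then 1 else 0) + occurrences v l) v ++ expand (suc v) (multiplicities (suc v) r (v ∷ l))) (≡ᵇ-refl v) ⟨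
    expand v (multiplicities v (suc r) (v ∷ l))                             ∎
    where open ≡-Reasoning

  expand-multiplicities : ∀ r v l → SortedFrom v l → (∀ {y} → y ∈ l → y < v + r) → l ≡ expand v (multiplicities v r l)
  expand-multiplicities zero    v []      _           _     = refl
  expand-multiplicities zero    v (x ∷ l) (v≤x ∷ _) bound = ⊥-elim (ℕP.<⇒≱ (bound (here refl)) (subst (_≤ x) (sym (ℕP.+-identityʳ v)) v≤x))
  expand-multiplicities (suc r) v []      _           _     = expand-multiplicities r (suc v) [] [] λ ()
  expand-multiplicities (suc r) v (x ∷ l) (v≤x ∷ s) bound =
    [ (λ v<x → trans (expand-multiplicities r (suc v) (x ∷ l) (v<x ∷ s) (λ {y} y∈ → subst (y <_) (ℕP.+-suc v r) (bound y∈)))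
                     (expand-multiplicities-skip r v<x s))
    , (λ v≡x → expand-multiplicities-head r v≡x (expand-multiplicities (suc r) v l (subst (λ b → SortedFrom b l) (sym v≡x) s) (bound ∘ there)))
    ]′ (ℕP.m≤n⇒m<n∨m≡n v≤x)

  product-factorials : ∀ l r v (g : ℕ → ℕ) → (∀ i → g i ≡ occurrences (v + i) l !) →
                       ℕL.product (applyUpTo g r) ≡ factProd (multiplicities v r l)
  product-factorials l zero    v g g≗ = refl
  product-factorials l (suc r) v g g≗ = cong₂ _*_ (trans (g≗ 0) (cong (λ u → occurrences u l !) (ℕP.+-identityʳ v)))
    (product-factorials l r (suc v) (g ∘ suc) λ i → trans (g≗ (suc i)) (cong (λ u → occurrences u l !) (ℕP.+-suc v i)))

  toPartition : List ℕ → Partition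
  toPartition l = length l , fromList l

  toPartition-toList : ∀ {m} (L : Vec ℕ m) → toPartition (toList L) ≡ (m , L)
  toPartition-toList Vec.[]       = refl
  toPartition-toList (x Vec.∷ L) = cong (λ { (n , V) → suc n , x Vec.∷ V }) (toPartition-toList L)

  allPos-fromList : ∀ l → (∀ {y} → y ∈ l → 1 ≤ y) → T (allPos (fromList l))
  allPos-fromList []      pos = _
  allPos-fromList (x ∷ l) pos = ∧⁺ (ℕP.≤⇒≤ᵇ (pos (here refl))) (allPos-fromList l (pos ∘ there))

  allPos⇒positive : ∀ {m} (L : Vec ℕ m) → T (allPos L) → ∀ {y} → y ∈ toList L → 1 ≤ y
  allPos⇒positive (x Vec.∷ L) t (here refl) = ℕP.≤ᵇ⇒≤ 1 x (proj₁ (∧⁻ t))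
  allPos⇒positive (x Vec.∷ L) t (there y∈)  = allPos⇒positive L (proj₂ (∧⁻ {1 ≤ᵇ x} t)) y∈

  nondecr-fromList : ∀ {b} l → SortedFrom b l → T (nondecr (fromList l))
  nondecr-fromList []          _                  = _
  nondecr-fromList (x ∷ [])    _                  = _
  nondecr-fromList (x ∷ y ∷ l) (_ ∷ s@(x≤y ∷ _)) = ∧⁺ (ℕP.≤⇒≤ᵇ x≤y) (nondecr-fromList (y ∷ l) s)

  nondecr⇒SortedFrom : ∀ {m} b (L : Vec ℕ m) → T (nondecr L) → (∀ {y} → y ∈ toList L → b ≤ y) → SortedFrom b (toList L)
  nondecr⇒SortedFrom b Vec.[]         t lower = []
  nondecr⇒SortedFrom b (x Vec.∷ L) t lower = sortedFrom b x L (lower (here refl)) t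
    where
    sortedFrom : ∀ b x {m} (L : Vec ℕ m) → b ≤ x → T (nondecr (x Vec.∷ L)) → SortedFrom b (x ∷ toList L)
    sortedFrom b x Vec.[]         b≤x t = b≤x ∷ []
    sortedFrom b x (y Vec.∷ L) b≤x t = b≤x ∷ sortedFrom x y L (ℕP.≤ᵇ⇒≤ x y (proj₁ (∧⁻ t))) (proj₂ (∧⁻ {x ≤ᵇ y} t))

  sum-toList : ∀ {m} (L : Vec ℕ m) → Vec.sum L ≡ ℕL.sum (toList L)
  sum-toList Vec.[]       = refl
  sum-toList (x Vec.∷ L) = cong (x +_) (sum-toList L)

  count-toList : ∀ {m} x (L : Vec ℕ m) → count x L ≡ occurrences x (toList L)
  count-toList x Vec.[]       = refl
  count-toList x (y Vec.∷ L) = cong ((if x ≡ᵇ y then 1 else 0) +_) (count-toList x L)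

  length≤sum : ∀ l → (∀ {y} → y ∈ l → 1 ≤ y) → length l ≤ ℕL.sum l
  length≤sum []      pos = z≤n
  length≤sum (x ∷ l) pos = ℕP.+-mono-≤ (pos (here refl)) (length≤sum l (pos ∘ there))

  vecsUpTo-complete : ∀ n b (V : Vec ℕ n) → (∀ {y} → y ∈ toList V → y ≤ b) → V ∈ vecsUpTo n b
  vecsUpTo-complete zero    b Vec.[]         bound = here refl
  vecsUpTo-complete (suc n) b (x Vec.∷ V) bound =
    ∈-concat⁺′ (∈-map⁺ (x Vec.∷_) (vecsUpTo-complete n b V (bound ∘ there)))
               (∈-map⁺ (λ x → map (x Vec.∷_) (vecsUpTo n b)) (∈-upTo⁺ (s≤s (bound (here refl)))))

  vecsUpTo-sound : ∀ n b {V : Vec ℕ n} → V ∈ vecsUpTo n b → ∀ {y} → y ∈ toList V → y ≤ b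
  vecsUpTo-sound zero    b (here refl) ()
  vecsUpTo-sound (suc n) b V∈ y∈ with ∈-concat⁻′ (map (λ x → map (x Vec.∷_) (vecsUpTo n b)) (upTo (suc b))) V∈
  ... | ys , V∈ys , ys∈ with ∈-map⁻ (λ x → map (x Vec.∷_) (vecsUpTo n b)) ys∈
  ... | x , x∈ , refl with ∈-map⁻ (x Vec.∷_) V∈ys
  ... | V , V∈′ , refl with y∈
  ... | here refl  = ℕP.≤-pred (∈-upTo⁻ x∈)
  ... | there y∈′ = vecsUpTo-sound n b V∈′ y∈′

  vecsUpTo-unique : ∀ n b → Unique (vecsUpTo n b)
  vecsUpTo-unique zero    b = [] ∷ []
  vecsUpTo-unique (suc n) b = unique-concatMap (λ x → map (x Vec.∷_) (vecsUpTo n b)) (UniqueP.upTo⁺ (suc b))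
    (λ x → UniqueP.map⁺ (proj₂ ∘ ∷-injective) (vecsUpTo-unique n b)) sameHead
    where
    sameHead : ∀ {x y z} → z ∈ map (x Vec.∷_) (vecsUpTo n b) → z ∈ map (y Vec.∷_) (vecsUpTo n b) → x ≡ y
    sameHead zx zy with ∈-map⁻ _ zx | ∈-map⁻ _ zy
    ... | _ , _ , refl | _ , _ , e = proj₁ (∷-injective e)

  unique-map-injectiveOn : ∀ {A B : Set} (f : A → B) {xs} → Unique xs → (∀ {x y} → x ∈ xs → y ∈ xs → f x ≡ f y → x ≡ y) → Unique (map f xs)
  unique-map-injectiveOn f {[]}     []           inj = []
  unique-map-injectiveOn f {x ∷ xs} (x∉xs ∷ u) inj =
    ¬Any⇒All¬ _ fx∉ ∷ unique-map-injectiveOn f u (λ a∈ b∈ → inj (there a∈) (there b∈))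
    where
    fx∉ : ¬ Any (f x ≡_) (map f xs)
    fx∉ a with ∈-map⁻ f a
    ... | y , y∈ , e = All¬⇒¬Any x∉xs (subst (_∈ xs) (sym (inj (here refl) (there y∈) e)) y∈)

  IsPartitionOf : ℕ → ∀ {m} → Vec ℕ m → Bool
  IsPartitionOf k L = allPos L ∧ nondecr L ∧ (Vec.sum L ≡ᵇ k)

  partsOfSize : ℕ → ℕ → List Partition
  partsOfSize k m = map (m ,_) (filterᵇ (IsPartitionOf k) (vecsUpTo m k))

  ∈partitionsOf⁻ : ∀ k {p} → p ∈ partitionsOf k →
    ∃ λ m → ∃ λ (L : Vec ℕ m) → p ≡ (m , L) × L ∈ vecsUpTo m k × T (IsPartitionOf k L)
  ∈partitionsOf⁻ k p∈ with ∈-concat⁻′ (map (partsOfSize k) (upTo (suc k))) p∈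
  ... | ys , p∈ys , ys∈ with ∈-map⁻ (partsOfSize k) ys∈
  ... | m , _ , refl with ∈-map⁻ (m ,_) p∈ys
  ... | L , L∈ , refl = let L∈vecs , isPartition = ∈-filter⁻ (T? ∘ IsPartitionOf k) {xs = vecsUpTo m k} L∈ in
    m , L , refl , L∈vecs , isPartition

  ∈partitionsOf⁺ : ∀ k m (L : Vec ℕ m) → m < suc k → L ∈ vecsUpTo m k → T (IsPartitionOf k L) → (m , L) ∈ partitionsOf k
  ∈partitionsOf⁺ k m L m≤k L∈ t =
    ∈-concat⁺′ (∈-map⁺ (m ,_) (∈-filter⁺ (T? ∘ IsPartitionOf k) L∈ t)) (∈-map⁺ (partsOfSize k) (∈-upTo⁺ m≤k))

  partitionsOf-unique : ∀ k → Unique (partitionsOf k)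
  partitionsOf-unique k = unique-concatMap (partsOfSize k) (UniqueP.upTo⁺ (suc k))
    (λ m → UniqueP.map⁺ (λ { refl → refl }) (UniqueP.filter⁺ (T? ∘ IsPartitionOf k) (vecsUpTo-unique m k))) sameSize
    where
    sameSize : ∀ {x y z} → z ∈ partsOfSize k x → z ∈ partsOfSize k y → x ≡ y
    sameSize zx zy with ∈-map⁻ _ zx | ∈-map⁻ _ zy
    ... | _ , _ , refl | _ , _ , refl = refl

  -- Bell exponent vectors (j₀, j₁, …, j_k) correspond to partitions of k into at most N parts,
  -- j_i being the number of parts equal to i and j₀ = N minus the number of parts.
  module BellPartitions (k N : ℕ) where

    IsBellIndex : Vec ℕ (suc k) → Bool
    IsBellIndex j = (Vec.sum j ≡ᵇ N) ∧ (wsumFrom 1 j ≡ᵇ k + N)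

    indices : List (Vec ℕ (suc k))
    indices = filterᵇ IsBellIndex (vecsUpTo (suc k) N)

    partitions : List Partition
    partitions = filterᵇ (λ p → proj₁ p ≤ᵇ N) (partitionsOf k)

    partitionOf : Vec ℕ (suc k) → Partition
    partitionOf (j₀ Vec.∷ js) = toPartition (expand 1 js)

    ∈indices⇒IsBellIndex : ∀ {j} → j ∈ indices → T (IsBellIndex j)
    ∈indices⇒IsBellIndex j∈ = proj₂ (∈-filter⁻ (T? ∘ IsBellIndex) {xs = vecsUpTo (suc k) N} j∈)

    module _ (j₀ : ℕ) (js : Vec ℕ k) (isIndex : T (IsBellIndex (j₀ Vec.∷ js))) where

      j₀+#parts≡N : j₀ + Vec.sum js ≡ N
      j₀+#parts≡N = ℕP.≡ᵇ⇒≡ _ _ (proj₁ (∧⁻ isIndex))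

      sum-parts≡k : ℕL.sum (expand 1 js) ≡ k
      sum-parts≡k = trans (sum-expand 1 js) (ℕP.+-cancelʳ-≡ (j₀ + Vec.sum js) (wsumFrom 1 js) k (begin
        wsumFrom 1 js + (j₀ + Vec.sum js)     ≡⟨ solve 3 (λ w j s → w :+ (j :+ s) := j :+ con 0 :+ (w :+ s)) refl (wsumFrom 1 js) j₀ (Vec.sum js) ⟩
        j₀ + 0 + (wsumFrom 1 js + Vec.sum js) ≡⟨ cong (j₀ + 0 +_) (wsumFrom-suc 1 js) ⟨
        j₀ + 0 + wsumFrom 2 js                ≡⟨ ℕP.≡ᵇ⇒≡ _ _ (proj₂ (∧⁻ {Vec.sum (j₀ Vec.∷ js) ≡ᵇ N} isIndex)) ⟩
        k + N                                 ≡⟨ cong (k +_) j₀+#parts≡N ⟨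
        k + (j₀ + Vec.sum js)                 ∎))
        where
        open ≡-Reasoning
        open +-*-Solver

      partitionOf-∈ : partitionOf (j₀ Vec.∷ js) ∈ partitions
      partitionOf-∈ = ∈-filter⁺ (T? ∘ (λ p → proj₁ p ≤ᵇ N)) (∈partitionsOf⁺ k _ _ #parts≤k bounded isPartition) (ℕP.≤⇒≤ᵇ #parts≤N)
        where
        parts = expand 1 js
        bounds : ∀ {y} → y ∈ parts → 1 ≤ y × y < suc k
        bounds = ∈-expand-bounds 1 js
        #parts≤N : length parts ≤ N
        #parts≤N = subst (_≤ N) (sym (length-expand 1 js)) (subst (Vec.sum js ≤_) j₀+#parts≡N (ℕP.m≤n+m (Vec.sum js) j₀))
        #parts≤k : length parts < suc k
        #parts≤k = s≤s (subst (length parts ≤_) sum-parts≡k (length≤sum parts (proj₁ ∘ bounds)))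
        bounded : fromList parts ∈ vecsUpTo (length parts) k
        bounded = vecsUpTo-complete _ k (fromList parts) λ {y} y∈ → ℕP.≤-pred (proj₂ (bounds (subst (y ∈_) (toList∘fromList parts) y∈)))
        isPartition : T (IsPartitionOf k (fromList parts))
        isPartition = ∧⁺ (allPos-fromList parts (proj₁ ∘ bounds)) (∧⁺ (nondecr-fromList parts (expand-sorted 1 js))
          (ℕP.≡⇒≡ᵇ _ _ (trans (sum-toList (fromList parts)) (trans (cong ℕL.sum (toList∘fromList parts)) sum-parts≡k))))

    module _ {m} {L : Vec ℕ m} (m≤N : m ≤ N) (L∈ : L ∈ vecsUpTo m k) (isPartition : T (IsPartitionOf k L)) where

      private
        js : Vec ℕ k
        js = multiplicities 1 k (toList L)
        L≡expand : toList L ≡ expand 1 js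
        L≡expand = expand-multiplicities k 1 (toList L)
          (nondecr⇒SortedFrom 1 L (proj₁ (∧⁻ (proj₂ (∧⁻ {allPos L} isPartition)))) (allPos⇒positive L (proj₁ (∧⁻ isPartition))))
          (s≤s ∘ vecsUpTo-sound m k L∈)
        #parts : Vec.sum js ≡ m
        #parts = trans (sym (length-expand 1 js)) (trans (cong length (sym L≡expand)) (length-toList L))

      indexOf : Vec ℕ (suc k)
      indexOf = (N ∸ m) Vec.∷ js

      partitionOf-indexOf : partitionOf indexOf ≡ (m , L)
      partitionOf-indexOf = trans (cong toPartition (sym L≡expand)) (toPartition-toList L)

      indexOf-∈ : indexOf ∈ indices
      indexOf-∈ = ∈-filter⁺ (T? ∘ IsBellIndex) (vecsUpTo-complete (suc k) N indexOf bounded)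
                            (∧⁺ (ℕP.≡⇒≡ᵇ _ _ sum≡N) (ℕP.≡⇒≡ᵇ _ _ weight≡k+N))
        where
        bounded : ∀ {y} → y ∈ toList indexOf → y ≤ N
        bounded (here refl) = ℕP.m∸n≤m N m
        bounded (there y∈)  = ℕP.≤-trans (subst (_ ≤_) (length-toList L) (multiplicities-bounded k 1 (toList L) y∈)) m≤N
        sum≡N : (N ∸ m) + Vec.sum js ≡ N
        sum≡N = trans (cong ((N ∸ m) +_) #parts) (ℕP.m∸n+n≡m m≤N)
        weight≡k : wsumFrom 1 js ≡ k
        weight≡k = trans (sym (sum-expand 1 js)) (trans (cong ℕL.sum (sym L≡expand))
                     (trans (sym (sum-toList L)) (ℕP.≡ᵇ⇒≡ _ _ (proj₂ (∧⁻ (proj₂ (∧⁻ {allPos L} isPartition)))))))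
        weight≡k+N : (N ∸ m) + 0 + wsumFrom 2 js ≡ k + N
        weight≡k+N = begin
          (N ∸ m) + 0 + wsumFrom 2 js ≡⟨ cong₂ _+_ (ℕP.+-identityʳ (N ∸ m)) (trans (wsumFrom-suc 1 js) (cong₂ _+_ weight≡k #parts)) ⟩
          (N ∸ m) + (k + m)           ≡⟨ solve 3 (λ a k m → a :+ (k :+ m) := k :+ (a :+ m)) refl (N ∸ m) k m ⟩
          k + ((N ∸ m) + m)           ≡⟨ cong (k +_) (ℕP.m∸n+n≡m m≤N) ⟩
          k + N                       ∎
          where
          open ≡-Reasoning
          open +-*-Solver

    partitionOf-injectiveOn : ∀ {x y} → x ∈ indices → y ∈ indices → partitionOf x ≡ partitionOf y → x ≡ y
    partitionOf-injectiveOn {j₀ Vec.∷ js} {j₀′ Vec.∷ js′} x∈ y∈ e = cong₂ Vec._∷_ j₀≡j₀′ js≡js′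
      where
      parts≡ : expand 1 js ≡ expand 1 js′
      parts≡ = trans (sym (toList∘fromList _)) (trans (cong (toList ∘ proj₂) e) (toList∘fromList _))
      js≡js′ : js ≡ js′
      js≡js′ = trans (sym (multiplicities-expand 1 js)) (trans (cong (multiplicities 1 k) parts≡) (multiplicities-expand 1 js′))
      j₀≡j₀′ : j₀ ≡ j₀′
      j₀≡j₀′ = begin
        j₀                           ≡⟨ ℕP.m+n∸n≡m j₀ (Vec.sum js) ⟨
        j₀ + Vec.sum js ∸ Vec.sum js   ≡⟨ cong₂ _∸_ (trans (j₀+#parts≡N j₀ js (∈indices⇒IsBellIndex x∈)) (sym (j₀+#parts≡N j₀′ js′ (∈indices⇒IsBellIndex y∈))))
                                                  (cong Vec.sum js≡js′) ⟩
        j₀′ + Vec.sum js′ ∸ Vec.sum js′ ≡⟨ ℕP.m+n∸n≡m j₀′ (Vec.sum js′) ⟩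
        j₀′                          ∎
        where open ≡-Reasoning

    map-partitionOf-↭ : map partitionOf indices ↭ partitions
    map-partitionOf-↭ = unique-⊆-⊇⇒↭
      (unique-map-injectiveOn partitionOf (UniqueP.filter⁺ (T? ∘ IsBellIndex) (vecsUpTo-unique (suc k) N)) partitionOf-injectiveOn)
      (UniqueP.filter⁺ (T? ∘ (λ p → proj₁ p ≤ᵇ N)) (partitionsOf-unique k)) image⊆ ⊆image
      where
      image⊆ : ∀ {p} → p ∈ map partitionOf indices → p ∈ partitions
      image⊆ p∈ with ∈-map⁻ partitionOf p∈
      ... | (j₀ Vec.∷ js) , j∈ , refl = partitionOf-∈ j₀ js (∈indices⇒IsBellIndex j∈)
      ⊆image : ∀ {p} → p ∈ partitions → p ∈ map partitionOf indices
      ⊆image p∈ with ∈-filter⁻ (T? ∘ (λ p → proj₁ p ≤ᵇ N)) {xs = partitionsOf k} p∈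
      ... | p∈partitions , m≤ᵇN with ∈partitionsOf⁻ k p∈partitions
      ... | m , L , refl , L∈ , isPartition = let m≤N = ℕP.≤ᵇ⇒≤ m N m≤ᵇN in
        subst (_∈ map partitionOf indices) (partitionOf-indexOf m≤N L∈ isPartition) (∈-map⁺ partitionOf (indexOf-∈ m≤N L∈ isPartition))

    Cstb-partitionOf : ∀ j₀ js → Cstb k (partitionOf (j₀ Vec.∷ js)) ≡ factProd js
    Cstb-partitionOf j₀ js = begin
      ℕL.product (map (λ x → count (suc x) (fromList parts) !) (upTo k))  ≡⟨ cong ℕL.product (ListP.map-applyUpTo id _ k) ⟩
      ℕL.product (applyUpTo (λ x → count (suc x) (fromList parts) !) k)  ≡⟨ product-factorials parts k 1 _ (λ i → cong _!
                                                                              (trans (count-toList (suc i) (fromList parts)) (cong (occurrences (suc i)) (toList∘fromList parts)))) ⟩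
      factProd (multiplicities 1 k parts)                                 ≡⟨ cong factProd (multiplicities-expand 1 js) ⟩
      factProd js                                                          ∎
      where
      open ≡-Reasoning
      parts : List ℕ
      parts = expand 1 js

  factProd-positive : ∀ {r} (js : Vec ℕ r) → 1 ≤ factProd js
  factProd-positive Vec.[]       = s≤s z≤n
  factProd-positive (j Vec.∷ js) = ℕP.*-mono-≤ (ℕP.1≤n! j) (factProd-positive js)

open Combinatorics

module _ {c ℓ} (R : CommutativeRing c ℓ) where

  open CommutativeRing R
  open import Algebra.Properties.Ring ring using (-‿involutive; -‿distribʳ-*; -‿distribˡ-*)
  open import Algebra.Solver.Ring.NaturalCoefficients.Default commutativeSemiring
  open import Data.List.Relation.Binary.Permutation.Propositional using (↭⇒↭ₛ′)
  open import Data.List.Relation.Binary.Permutation.Setoid.Properties setoid using (foldr-commMonoid)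
  open import Data.List.Membership.Propositional.Properties using (∈-allFin; ∈-filter⁺)
  open import Data.List.Relation.Unary.Any using (here; there)
  open import Relation.Nullary.Decidable using (T?)
  open import Relation.Binary.Reasoning.Setoid setoid

  Σ[_] Π[_] : ∀ {a} {A : Set a} → List A → (A → Carrier) → Carrier
  Σ[ xs ] f = rsum R (map f xs)
  Π[ xs ] f = rprod R (map f xs)

  rsum-↭ : ∀ {xs ys} → xs ↭ ys → rsum R xs ≈ rsum R ys
  rsum-↭ p = foldr-commMonoid +-isCommutativeMonoid (↭⇒↭ₛ′ isEquivalence p)

  rsum-++ : ∀ xs ys → rsum R (xs ++ ys) ≈ rsum R xs + rsum R ys
  rsum-++ []       ys = sym (+-identityˡ _)
  rsum-++ (x ∷ xs) ys = trans (+-congˡ (rsum-++ xs ys)) (sym (+-assoc _ _ _))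

  Σ-cong-∈ : ∀ {a} {A : Set a} {f g : A → Carrier} xs → (∀ {x} → x ∈ xs → f x ≈ g x) → Σ[ xs ] f ≈ Σ[ xs ] g
  Σ-cong-∈ []       f≈g = refl
  Σ-cong-∈ (x ∷ xs) f≈g = +-cong (f≈g (here ≡.refl)) (Σ-cong-∈ xs (f≈g ∘ there))

  Σ-cong : ∀ {a} {A : Set a} {f g : A → Carrier} xs → (∀ x → f x ≈ g x) → Σ[ xs ] f ≈ Σ[ xs ] g
  Σ-cong xs f≈g = Σ-cong-∈ xs λ {x} _ → f≈g x

  Π-cong : ∀ {a} {A : Set a} {f g : A → Carrier} xs → (∀ x → f x ≈ g x) → Π[ xs ] f ≈ Π[ xs ] g
  Π-cong []       f≈g = refl
  Π-cong (x ∷ xs) f≈g = *-cong (f≈g x) (Π-cong xs f≈g)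

  Σ-concatMap : ∀ {a b} {A : Set a} {B : Set b} (f : B → Carrier) (g : A → List B) xs →
                Σ[ concatMap g xs ] f ≈ Σ[ xs ] (λ x → Σ[ g x ] f)
  Σ-concatMap f g []       = refl
  Σ-concatMap f g (x ∷ xs) = begin
    rsum R (map f (g x ++ concatMap g xs))          ≡⟨ ≡.cong (rsum R) (ListP.map-++ f (g x) _) ⟩
    rsum R (map f (g x) ++ map f (concatMap g xs))  ≈⟨ rsum-++ (map f (g x)) _ ⟩
    Σ[ g x ] f + Σ[ concatMap g xs ] f              ≈⟨ +-congˡ (Σ-concatMap f g xs) ⟩
    Σ[ g x ] f + Σ[ xs ] (λ x → Σ[ g x ] f)         ∎

  Σ-*ʳ : ∀ {a} {A : Set a} (c : Carrier) (f : A → Carrier) xs → Σ[ xs ] (λ x → f x * c) ≈ Σ[ xs ] f * c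
  Σ-*ʳ c f []       = sym (zeroˡ c)
  Σ-*ʳ c f (x ∷ xs) = trans (+-congˡ (Σ-*ʳ c f xs)) (sym (distribʳ c _ _))

  Σ-const : ∀ {a} {A : Set a} (c : Carrier) (xs : List A) → Σ[ xs ] (λ _ → c) ≈ fromℕ R (length xs) * c
  Σ-const c []       = sym (zeroˡ c)
  Σ-const c (x ∷ xs) = trans (+-congˡ (Σ-const c xs)) (trans (+-congʳ (sym (*-identityˡ c))) (sym (distribʳ c 1# _)))

  Π-1# : ∀ {a} {A : Set a} (xs : List A) → Π[ xs ] (λ _ → 1#) ≈ 1#
  Π-1# []       = refl
  Π-1# (x ∷ xs) = trans (*-identityˡ _) (Π-1# xs)

  Π-* : ∀ {a} {A : Set a} (f g : A → Carrier) xs → Π[ xs ] (λ x → f x * g x) ≈ Π[ xs ] f * Π[ xs ] g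
  Π-* f g []       = sym (*-identityˡ 1#)
  Π-* f g (x ∷ xs) = trans (*-congˡ (Π-* f g xs))
    (solve 4 (λ a b c d → (a :* b) :* (c :* d) := (a :* c) :* (b :* d)) refl (f x) (g x) _ _)

  Π-scale : ∀ {a} {A : Set a} (c : Carrier) (f : A → Carrier) xs → Π[ xs ] (λ x → c * f x) ≈ pow R c (length xs) * Π[ xs ] f
  Π-scale c f []       = sym (*-identityˡ 1#)
  Π-scale c f (x ∷ xs) = trans (*-congˡ (Π-scale c f xs))
    (solve 4 (λ a b p d → (a :* b) :* (p :* d) := (a :* p) :* (b :* d)) refl c (f x) _ _)

  Π-comm : ∀ {a b} {A : Set a} {B : Set b} (h : A → B → Carrier) xs ys →
           Π[ xs ] (λ x → Π[ ys ] (h x)) ≈ Π[ ys ] (λ y → Π[ xs ] (λ x → h x y))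
  Π-comm h []       ys = sym (Π-1# ys)
  Π-comm h (x ∷ xs) ys = trans (*-congˡ (Π-comm h xs ys)) (sym (Π-* (h x) (λ y → Π[ xs ] (λ x → h x y)) ys))

  Π-filterᵇ : ∀ {a} {A : Set a} (p : A → Bool) (f : A → Carrier) xs →
              Π[ filterᵇ p xs ] f ≈ Π[ xs ] (λ x → if p x then f x else 1#)
  Π-filterᵇ p f []       = refl
  Π-filterᵇ p f (x ∷ xs) with p x
  ... | true  = *-congˡ (Π-filterᵇ p f xs)
  ... | false = trans (Π-filterᵇ p f xs) (sym (*-identityˡ _))

  if-Π : ∀ {a} {A : Set a} (b : Bool) (g : A → Carrier) ys → (if b then Π[ ys ] g else 1#) ≈ Π[ ys ] (λ y → if b then g y else 1#)
  if-Π true  g ys = refl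
  if-Π false g ys = sym (Π-1# ys)

  Π-if-0# : ∀ {a} {A : Set a} (b : Bool) (f : A → Carrier) {xs x} → x ∈ xs →
            Π[ xs ] (λ y → if b then f y else 0#) ≈ (if b then Π[ xs ] f else 0#)
  Π-if-0# true  f _ = refl
  Π-if-0# false f {y ∷ xs} _ = zeroˡ _

  if-T : ∀ {a} {A : Set a} {b} {x y : A} → T b → (if b then x else y) ≡ x
  if-T {b = true} _ = ≡.refl

  if-¬T : ∀ {a} {A : Set a} {b} {x y : A} → ¬ T b → (if b then x else y) ≡ y
  if-¬T {b = false} _   = ≡.refl
  if-¬T {b = true}  ¬tt = ⊥-elim (¬tt _)

  map-allFin-suc : ∀ {a} {A : Set a} m (g : Fin (suc m) → A) → map g (allFin (suc m)) ≡ g Fin.zero ∷ map (g ∘ Fin.suc) (allFin m)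
  map-allFin-suc m g = ≡.cong (g Fin.zero ∷_) (≡.trans (ListP.map-tabulate Fin.suc g) (≡.sym (ListP.map-tabulate id (g ∘ Fin.suc))))

  Π-indicator-none : ∀ m (q : Fin m → Bool) (x : Carrier) → (∀ i → ¬ T (q i)) → Π[ allFin m ] (λ i → if q i then x else 1#) ≈ 1#
  Π-indicator-none m q x none = trans (Π-cong (allFin m) (λ i → reflexive (if-¬T (none i)))) (Π-1# (allFin m))

  Π-indicator-unique : ∀ m (q : Fin m → Bool) {i₀} (x : Carrier) → T (q i₀) → (∀ {i} → T (q i) → i ≡ i₀) →
                       Π[ allFin m ] (λ i → if q i then x else 1#) ≈ x
  Π-indicator-unique (suc m) q {Fin.zero} x qi₀ unique = begin
    Π[ allFin (suc m) ] (λ i → if q i then x else 1#)                             ≡⟨ ≡.cong (rprod R) (map-allFin-suc m _) ⟩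
    (if q Fin.zero then x else 1#) * Π[ allFin m ] (λ i → if q (Fin.suc i) then x else 1#)
      ≈⟨ *-cong (reflexive (if-T qi₀)) (Π-indicator-none m (q ∘ Fin.suc) x λ i t → case unique t of λ ()) ⟩
    x * 1#                                                                        ≈⟨ *-identityʳ x ⟩
    x                                                                             ∎
  Π-indicator-unique (suc m) q {Fin.suc i₀} x qi₀ unique = begin
    Π[ allFin (suc m) ] (λ i → if q i then x else 1#)                             ≡⟨ ≡.cong (rprod R) (map-allFin-suc m _) ⟩
    (if q Fin.zero then x else 1#) * Π[ allFin m ] (λ i → if q (Fin.suc i) then x else 1#)
      ≈⟨ *-cong (reflexive (if-¬T λ t → case unique t of λ ()))
                (Π-indicator-unique m (q ∘ Fin.suc) x qi₀ (Data.Fin.Properties.suc-injective ∘ unique)) ⟩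
    1# * x                                                                        ≈⟨ *-identityˡ x ⟩
    x                                                                             ∎
    where import Data.Fin.Properties

  fromℕ-+ : ∀ a b → fromℕ R (a ℕ.+ b) ≈ fromℕ R a + fromℕ R b
  fromℕ-+ zero    b = sym (+-identityˡ _)
  fromℕ-+ (suc a) b = trans (+-congˡ (fromℕ-+ a b)) (sym (+-assoc _ _ _))

  fromℕ-* : ∀ a b → fromℕ R (a ℕ.* b) ≈ fromℕ R a * fromℕ R b
  fromℕ-* zero    b = sym (zeroˡ _)
  fromℕ-* (suc a) b = trans (fromℕ-+ b (a ℕ.* b)) (trans (+-cong (sym (*-identityˡ _)) (fromℕ-* a b)) (sym (distribʳ _ _ _)))

  pow-1# : ∀ n → pow R 1# n ≈ 1#
  pow-1# zero    = refl
  pow-1# (suc n) = trans (*-identityˡ _) (pow-1# n)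

  Σ-∷ʳ : ∀ {a} {A : Set a} (f : A → Carrier) xs y → Σ[ xs List.∷ʳ y ] f ≈ Σ[ xs ] f + f y
  Σ-∷ʳ f xs y = begin
    rsum R (map f (xs ++ y ∷ []))     ≡⟨ ≡.cong (rsum R) (ListP.map-++ f xs (y ∷ [])) ⟩
    rsum R (map f xs ++ f y ∷ [])     ≈⟨ rsum-++ (map f xs) (f y ∷ []) ⟩
    Σ[ xs ] f + (f y + 0#)            ≈⟨ +-congˡ (+-identityʳ (f y)) ⟩
    Σ[ xs ] f + f y                   ∎

  Σ-upTo-truncated : ∀ (x : Carrier) {N} M → N ≤ M → Σ[ upTo M ] (λ n → if suc n ≤ᵇ N then x else 0#) ≈ fromℕ R N * x
  Σ-upTo-truncated x {N} M N≤M = trans (beyond-N M N≤M) (up-to-N N ℕP.≤-refl)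
    where
    term : ℕ → Carrier
    term n = if suc n ≤ᵇ N then x else 0#
    Σ-upTo-suc : ∀ K → Σ[ upTo (suc K) ] term ≈ Σ[ upTo K ] term + term K
    Σ-upTo-suc K = trans (reflexive (≡.cong (λ l → Σ[ l ] term) (≡.sym (ListP.upTo-∷ʳ K)))) (Σ-∷ʳ term (upTo K) K)
    up-to-N : ∀ K → K ≤ N → Σ[ upTo K ] term ≈ fromℕ R K * x
    up-to-N zero    _   = sym (zeroˡ x)
    up-to-N (suc K) K<N = begin
      Σ[ upTo (suc K) ] term         ≈⟨ Σ-upTo-suc K ⟩
      Σ[ upTo K ] term + term K      ≈⟨ +-cong (up-to-N K (ℕP.<⇒≤ K<N)) (reflexive (if-T (ℕP.≤⇒≤ᵇ K<N))) ⟩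
      fromℕ R K * x + x              ≈⟨ +-comm _ x ⟩
      x + fromℕ R K * x              ≈⟨ +-congʳ (*-identityˡ x) ⟨
      1# * x + fromℕ R K * x         ≈⟨ distribʳ x 1# (fromℕ R K) ⟨
      fromℕ R (suc K) * x            ∎
    beyond-N : ∀ M → N ≤ M → Σ[ upTo M ] term ≈ Σ[ upTo N ] term
    beyond-N M N≤M with ℕP.m≤n⇒m<n∨m≡n N≤M
    ... | inj₂ ≡.refl = refl
    beyond-N (suc M) _ | inj₁ (s≤s N≤M) = begin
      Σ[ upTo (suc M) ] term         ≈⟨ Σ-upTo-suc M ⟩
      Σ[ upTo M ] term + term M      ≈⟨ +-cong (beyond-N M N≤M) (reflexive (if-¬T λ t → ℕP.<⇒≱ (s≤s N≤M) (ℕP.≤ᵇ⇒≤ _ _ t))) ⟩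
      Σ[ upTo N ] term + 0#          ≈⟨ +-identityʳ _ ⟩
      Σ[ upTo N ] term               ∎

  -- The signed cycle polynomial

  fallingFactorial : Carrier → ℕ → Carrier
  fallingFactorial x zero    = 1#
  fallingFactorial x (suc m) = fallingFactorial x m * (x - fromℕ R m)

  module _ {m} {σ : Vec (Fin m) m} (perm : IsPermutation σ) where

    cycleOf : Fin m → List (Fin m)
    cycleOf i = filterᵇ (inCycle σ i) (allFin m)

    -- Each j lies in the cycle of exactly one representative.
    Π-cycles : (f : Fin m → Carrier) → Π[ filterᵇ (isCycleRep σ) (allFin m) ] (λ i → Π[ cycleOf i ] f) ≈ Π[ allFin m ] f
    Π-cycles f = begin
      Π[ filterᵇ (isCycleRep σ) (allFin m) ] (λ i → Π[ cycleOf i ] f)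
        ≈⟨ Π-filterᵇ (isCycleRep σ) _ (allFin m) ⟩
      Π[ allFin m ] (λ i → if isCycleRep σ i then Π[ cycleOf i ] f else 1#)
        ≈⟨ Π-cong (allFin m) (λ i → trans (if-cong (isCycleRep σ i) (Π-filterᵇ (inCycle σ i) f (allFin m))) (if-Π (isCycleRep σ i) _ (allFin m))) ⟩
      Π[ allFin m ] (λ i → Π[ allFin m ] (h i))
        ≈⟨ Π-comm h (allFin m) (allFin m) ⟩
      Π[ allFin m ] (λ j → Π[ allFin m ] (λ i → h i j))
        ≈⟨ Π-cong (allFin m) (λ j → trans (Π-cong (allFin m) (λ i → reflexive (if-∧ (isCycleRep σ i) (inCycle σ i j))))
             (let i , i-rep = cycleRep-exists σ perm j in
              Π-indicator-unique m (IsRepOf σ j) (f j) i-rep λ i′-rep → cycleRep-unique σ perm i′-rep i-rep)) ⟩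
      Π[ allFin m ] f ∎
      where
      h : Fin m → Fin m → Carrier
      h i j = if isCycleRep σ i then (if inCycle σ i j then f j else 1#) else 1#
      if-cong : ∀ b {x y} → x ≈ y → (if b then x else 1#) ≈ (if b then y else 1#)
      if-cong true  x≈y = x≈y
      if-cong false _   = refl
      if-∧ : ∀ a b {x : Carrier} → (if a then (if b then x else 1#) else 1#) ≡ (if a ∧ b then x else 1#)
      if-∧ true  b = ≡.refl
      if-∧ false b = ≡.refl

    𝔸-truncFam : ∀ M {N} → N ≤ M → (a : ℕ → Carrier) (L : Vec ℕ m) →
                 𝔸 R M m σ L (truncFam R N a) ≈ pow R (fromℕ R N) (#cycles σ) * Π[ allFin m ] (λ j → a (lookup L j))
    𝔸-truncFam M {N} N≤M a L = begin
      𝔸 R M m σ L (truncFam R N a)                            ≈⟨ Π-cong reps cycleFactor ⟩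
      Π[ reps ] (λ i → fromℕ R N * Π[ cycleOf i ] f)          ≈⟨ Π-scale (fromℕ R N) _ reps ⟩
      pow R (fromℕ R N) (#cycles σ) * Π[ reps ] (λ i → Π[ cycleOf i ] f) ≈⟨ *-congˡ (Π-cycles f) ⟩
      pow R (fromℕ R N) (#cycles σ) * Π[ allFin m ] f          ∎
      where
      f : Fin m → Carrier
      f j = a (lookup L j)
      reps : List (Fin m)
      reps = filterᵇ (isCycleRep σ) (allFin m)
      cycleFactor : ∀ i → Σ[ upTo M ] (λ n → Π[ cycleOf i ] (λ j → truncFam R N a (suc n) (lookup L j))) ≈ fromℕ R N * Π[ cycleOf i ] f
      cycleFactor i = trans (Σ-cong (upTo M) λ n → Π-if-0# (suc n ≤ᵇ N) f (∈-filter⁺ (T? ∘ inCycle σ i) (∈-allFin i) (inCycle-refl σ perm i)))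
                            (Σ-upTo-truncated _ M N≤M)

  sign-addFixedPoint : ∀ {m} (σ : Vec (Fin m) m) → sign R (addFixedPoint σ) ≡ sign R σ
  sign-addFixedPoint σ = ≡.cong (λ n → if even n then 1# else - 1#) (inversions-addFixedPoint σ)

  sign-insertAfter : ∀ {m} (σ : Vec (Fin m) m) j → IsPermutation σ → sign R (insertAfter σ j) ≈ - sign R σ
  sign-insertAfter σ j perm =
    trans (reflexive (≡.cong (λ b → if b then 1# else - 1#) (InversionsOfInsertAfter.even-inversions-insertAfter σ j perm)))
          (flip (even (inversions σ)))
    where
    flip : ∀ b → (if not b then 1# else - 1#) ≈ - (if b then 1# else - 1#)
    flip true  = refl
    flip false = sym (-‿involutive 1#)

  module _ (x : Carrier) where

    signedPower : ∀ {m} → Vec (Fin m) m → Carrier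
    signedPower σ = sign R σ * pow R x (#cycles σ)

    Σ-extensions : ∀ {m} (σ : Vec (Fin m) m) → IsPermutation σ → Σ[ extensions σ ] signedPower ≈ signedPower σ * (x - fromℕ R m)
    Σ-extensions {m} σ perm = begin
      signedPower (addFixedPoint σ) + Σ[ map (insertAfter σ) (allFin m) ] signedPower
        ≈⟨ +-cong fixed (trans (reflexive (≡.cong (rsum R) (≡.sym (ListP.map-∘ (allFin m)))))
                               (trans (Σ-cong (allFin m) inserted) (Σ-const (- signedPower σ) (allFin m)))) ⟩
      signedPower σ * x + fromℕ R (length (allFin m)) * - signedPower σ
        ≈⟨ +-congˡ (*-congʳ (reflexive (≡.cong (fromℕ R) (ListP.length-tabulate {n = m} id)))) ⟩
      signedPower σ * x + fromℕ R m * - signedPower σ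
        ≈⟨ +-congˡ (trans (*-comm _ _) (sym (-‿distribˡ-* _ _))) ⟩
      signedPower σ * x + - (signedPower σ * fromℕ R m)
        ≈⟨ +-congˡ (-‿distribʳ-* _ _) ⟩
      signedPower σ * x + signedPower σ * - fromℕ R m
        ≈⟨ distribˡ _ _ _ ⟨
      signedPower σ * (x - fromℕ R m) ∎
      where
      fixed : signedPower (addFixedPoint σ) ≈ signedPower σ * x
      fixed = trans (*-cong (reflexive (sign-addFixedPoint σ)) (reflexive (≡.cong (pow R x) (#cycles-addFixedPoint σ perm))))
                    (solve 3 (λ s x p → s :* (x :* p) := s :* p :* x) refl (sign R σ) x _)
      inserted : ∀ j → signedPower (insertAfter σ j) ≈ - signedPower σ
      inserted j = trans (*-cong (sign-insertAfter σ j perm) (reflexive (≡.cong (pow R x) (#cycles-insertAfter σ j perm))))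
                         (sym (-‿distribˡ-* _ _))

    Σ-signedPower : ∀ m → Σ[ perms m ] signedPower ≈ fallingFactorial x m
    Σ-signedPower zero    = trans (+-identityʳ _) (*-identityˡ _)
    Σ-signedPower (suc m) = begin
      Σ[ perms (suc m) ] signedPower                            ≈⟨ rsum-↭ (↭P.map⁺ signedPower (perms-suc-↭ m)) ⟩
      Σ[ concatMap extensions (perms m) ] signedPower           ≈⟨ Σ-concatMap signedPower extensions (perms m) ⟩
      Σ[ perms m ] (λ σ → Σ[ extensions σ ] signedPower)        ≈⟨ Σ-cong-∈ (perms m) (λ σ∈ → Σ-extensions _ (∈perms⇒permutation σ∈)) ⟩
      Σ[ perms m ] (λ σ → signedPower σ * (x - fromℕ R m))      ≈⟨ Σ-*ʳ _ signedPower (perms m) ⟩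
      Σ[ perms m ] signedPower * (x - fromℕ R m)                ≈⟨ *-congʳ (Σ-signedPower m) ⟩
      fallingFactorial x (suc m)                                ∎

  [x+y]-y≈x : ∀ x y → (x + y) - y ≈ x
  [x+y]-y≈x x y = trans (+-assoc x y (- y)) (trans (+-congˡ (-‿inverseʳ y)) (+-identityʳ x))

  factorial-split : ∀ m j → fromℕ R (j !) * fallingFactorial (fromℕ R (j ℕ.+ m)) m ≈ fromℕ R ((j ℕ.+ m) !)
  factorial-split zero    j = trans (*-identityʳ _) (reflexive (≡.cong (λ n → fromℕ R (n !)) (≡.sym (ℕP.+-identityʳ j))))
  factorial-split (suc m) j = begin
    fromℕ R (j !) * (fallingFactorial x m * (x - fromℕ R m))    ≈⟨ *-congˡ (*-cong (reflexive (≡.cong (λ n → fallingFactorial (fromℕ R n) m) j+sm≡sj+m)) x-m≈1+j) ⟩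
    fromℕ R (j !) * (fallingFactorial x′ m * fromℕ R (suc j))  ≈⟨ solve 3 (λ a f s → a :* (f :* s) := (s :* a) :* f) refl (fromℕ R (j !)) (fallingFactorial x′ m) (fromℕ R (suc j)) ⟩
    (fromℕ R (suc j) * fromℕ R (j !)) * fallingFactorial x′ m  ≈⟨ *-congʳ (fromℕ-* (suc j) (j !)) ⟨
    fromℕ R (suc j !) * fallingFactorial x′ m                  ≈⟨ factorial-split m (suc j) ⟩
    fromℕ R ((suc j ℕ.+ m) !)                                  ≡⟨ ≡.cong (λ n → fromℕ R (n !)) j+sm≡sj+m ⟨
    fromℕ R ((j ℕ.+ suc m) !)                                  ∎
    where
    j+sm≡sj+m : j ℕ.+ suc m ≡ suc j ℕ.+ m
    j+sm≡sj+m = ℕP.+-suc j m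
    x x′ : Carrier
    x  = fromℕ R (j ℕ.+ suc m)
    x′ = fromℕ R (suc j ℕ.+ m)
    x-m≈1+j : x - fromℕ R m ≈ fromℕ R (suc j)
    x-m≈1+j = trans (+-congʳ (trans (reflexive (≡.cong (fromℕ R) j+sm≡sj+m)) (fromℕ-+ (suc j) m))) ([x+y]-y≈x _ _)

  fallingFactorial-vanishes : ∀ {N m} → N < m → fallingFactorial (fromℕ R N) m ≈ 0#
  fallingFactorial-vanishes {N} {suc m} (s≤s N≤m) with ℕP.m≤n⇒m<n∨m≡n N≤m
  ... | inj₂ ≡.refl = trans (*-congˡ (-‿inverseʳ (fromℕ R N))) (zeroʳ _)
  ... | inj₁ N<m    = trans (*-congʳ (fallingFactorial-vanishes N<m)) (zeroˡ _)

  Π-++ : ∀ {a} {A : Set a} (f : A → Carrier) xs ys → Π[ xs ++ ys ] f ≈ Π[ xs ] f * Π[ ys ] f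
  Π-++ f []       ys = sym (*-identityˡ _)
  Π-++ f (x ∷ xs) ys = trans (*-congˡ (Π-++ f xs ys)) (sym (*-assoc _ _ _))

  Π-replicate : ∀ (f : ℕ → Carrier) n v → Π[ replicate n v ] f ≈ pow R (f v) n
  Π-replicate f zero    v = refl
  Π-replicate f (suc n) v = *-congˡ (Π-replicate f n v)

  -- monoFrom counts exponents from index i₀, and x_i = a_{i−1}; parts of size v ≥ 1 carry a_v.
  Π-expand : ∀ (a : ℕ → Carrier) w {r} (js : Vec ℕ r) →
             Π[ expand (suc w) js ] a ≈ monoFrom R (λ i → withA₀ R a (i ∸ 1)) (suc (suc w)) js
  Π-expand a w Vec.[]       = refl
  Π-expand a w (j Vec.∷ js) = begin
    Π[ replicate j (suc w) ++ expand (suc (suc w)) js ] a                ≈⟨ Π-++ a (replicate j (suc w)) _ ⟩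
    Π[ replicate j (suc w) ] a * Π[ expand (suc (suc w)) js ] a          ≈⟨ *-cong (Π-replicate a j (suc w)) (Π-expand a (suc w) js) ⟩
    monoFrom R (λ i → withA₀ R a (i ∸ 1)) (suc (suc w)) (j Vec.∷ js)     ∎

  Π-lookup-fromList : ∀ (f : ℕ → Carrier) l → Π[ allFin (length l) ] (λ j → f (lookup (fromList l) j)) ≈ Π[ l ] f
  Π-lookup-fromList f []      = refl
  Π-lookup-fromList f (x ∷ l) = trans (reflexive (≡.cong (rprod R) (map-allFin-suc (length l) _))) (*-congˡ (Π-lookup-fromList f l))

  Σ-filterᵇ : ∀ {a} {A : Set a} (p : A → Bool) (f : A → Carrier) → (∀ x → ¬ T (p x) → f x ≈ 0#) →
              ∀ xs → Σ[ xs ] f ≈ Σ[ filterᵇ p xs ] f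
  Σ-filterᵇ p f vanish []       = refl
  Σ-filterᵇ p f vanish (x ∷ xs) with p x in px
  ... | true  = +-congˡ (Σ-filterᵇ p f vanish xs)
  ... | false = trans (+-cong (vanish x (≡.subst T px)) (Σ-filterᵇ p f vanish xs)) (+-identityˡ _)

  -- Both sides as a sum over the Bell exponent vectors

  module _ (inv : ℕ → Carrier) (inv-spec : ∀ n → fromℕ R (suc n) * inv (suc n) ≈ 1#) where

    inverseʳ : ∀ {n} → 1 ≤ n → fromℕ R n * inv n ≈ 1#
    inverseʳ {suc n} _ = inv-spec n

    -- Inverses are unique, so inv is multiplicative on positive arguments.
    inv-* : ∀ {a b} → 1 ≤ a → 1 ≤ b → inv (a ℕ.* b) ≈ inv a * inv b
    inv-* {a} {b} 1≤a 1≤b = begin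
      inv (a ℕ.* b)                                              ≈⟨ *-identityʳ _ ⟨
      inv (a ℕ.* b) * 1#                                         ≈⟨ *-congˡ (trans (*-cong (inverseʳ 1≤a) (inverseʳ 1≤b)) (*-identityˡ 1#)) ⟨
      inv (a ℕ.* b) * ((fromℕ R a * inv a) * (fromℕ R b * inv b)) ≈⟨ solve 5 (λ i x y u v → i :* ((x :* u) :* (y :* v)) := (x :* y :* i) :* (u :* v))
                                                                      refl (inv (a ℕ.* b)) (fromℕ R a) (fromℕ R b) (inv a) (inv b) ⟩
      (fromℕ R a * fromℕ R b * inv (a ℕ.* b)) * (inv a * inv b)  ≈⟨ *-congʳ (trans (*-congʳ (sym (fromℕ-* a b))) (inverseʳ (ℕP.*-mono-≤ 1≤a 1≤b))) ⟩
      1# * (inv a * inv b)                                       ≈⟨ *-identityˡ _ ⟩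
      inv a * inv b                                              ∎

    module _ (k N : ℕ) (a : ℕ → Carrier) {M} (N≤M : N ≤ M) where

      open BellPartitions k N

      cycleSum : ∀ m → Vec ℕ m → Carrier
      cycleSum m L = Σ[ perms m ] (λ σ → sign R σ * 𝔸 R M m σ L (truncFam R N a))

      cycleSum≈ : ∀ m L → cycleSum m L ≈ fallingFactorial (fromℕ R N) m * Π[ allFin m ] (λ j → a (lookup L j))
      cycleSum≈ m L = begin
        cycleSum m L                                                    ≈⟨ Σ-cong-∈ (perms m) (λ σ∈ → trans (*-congˡ (𝔸-truncFam (∈perms⇒permutation σ∈) M N≤M a L)) (sym (*-assoc _ _ _))) ⟩
        Σ[ perms m ] (λ σ → signedPower (fromℕ R N) σ * Π[ allFin m ] (λ j → a (lookup L j)))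
                                                                        ≈⟨ Σ-*ʳ _ (signedPower (fromℕ R N)) (perms m) ⟩
        Σ[ perms m ] (signedPower (fromℕ R N)) * Π[ allFin m ] (λ j → a (lookup L j))
                                                                        ≈⟨ *-congʳ (Σ-signedPower (fromℕ R N) m) ⟩
        fallingFactorial (fromℕ R N) m * Π[ allFin m ] (λ j → a (lookup L j)) ∎

      rhsTerm : Partition → Carrier
      rhsTerm (m , L) = inv (Cstb k (m , L)) * cycleSum m L

      bellTerm : ∀ {D} → Vec ℕ D → Carrier
      bellTerm j = (fromℕ R (N !) * inv (factProd j)) * monoFrom R (λ i → withA₀ R a (i ∸ 1)) 1 j

      rhsTerm-tooLong : ∀ p → ¬ T (proj₁ p ≤ᵇ N) → rhsTerm p ≈ 0#
      rhsTerm-tooLong (m , L) m≰N = begin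
        inv (Cstb k (m , L)) * cycleSum m L                                               ≈⟨ *-congˡ (cycleSum≈ m L) ⟩
        inv (Cstb k (m , L)) * (fallingFactorial (fromℕ R N) m * Π[ allFin m ] (λ j → a (lookup L j)))
                                                                                          ≈⟨ *-congˡ (*-congʳ (fallingFactorial-vanishes (ℕP.≰⇒> (m≰N ∘ ℕP.≤⇒≤ᵇ {m} {N})))) ⟩
        inv (Cstb k (m , L)) * (0# * Π[ allFin m ] (λ j → a (lookup L j)))                ≈⟨ *-congˡ (zeroˡ _) ⟩
        inv (Cstb k (m , L)) * 0#                                                         ≈⟨ zeroʳ _ ⟩
        0#                                                                                ∎

      rhsTerm-partitionOf : ∀ {j} → j ∈ indices → rhsTerm (partitionOf j) ≈ bellTerm j
      rhsTerm-partitionOf {j₀ Vec.∷ js} j∈ = begin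
        inv (Cstb k (m , V)) * cycleSum m V          ≈⟨ *-cong (reflexive (≡.cong inv (Cstb-partitionOf j₀ js))) (cycleSum≈ m V) ⟩
        inv (factProd js) * (ff * Π[ allFin m ] (λ j → a (lookup V j)))
                                                     ≈⟨ *-congˡ (*-congˡ (trans (Π-lookup-fromList a parts) (Π-expand a 0 js))) ⟩
        inv (factProd js) * (ff * monomial)          ≈⟨ coefficients ⟨
        bellTerm (j₀ Vec.∷ js)                       ∎
        where
        parts : List ℕ
        parts = expand 1 js
        m : ℕ
        m = length parts
        V : Vec ℕ m
        V = fromList parts
        ff monomial : Carrier
        ff = fallingFactorial (fromℕ R N) m
        monomial = monoFrom R (λ i → withA₀ R a (i ∸ 1)) 2 js
        j₀+m≡N : j₀ ℕ.+ m ≡ N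
        j₀+m≡N = ≡.trans (≡.cong (j₀ ℕ.+_) (length-expand 1 js)) (j₀+#parts≡N j₀ js (∈indices⇒IsBellIndex j∈))
        N!≈ : fromℕ R (N !) ≈ fromℕ R (j₀ !) * ff
        N!≈ = sym (≡.subst (λ n → fromℕ R (j₀ !) * fallingFactorial (fromℕ R n) m ≈ fromℕ R (n !)) j₀+m≡N (factorial-split m j₀))
        coefficients : bellTerm (j₀ Vec.∷ js) ≈ inv (factProd js) * (ff * monomial)
        coefficients = begin
          (fromℕ R (N !) * inv (j₀ ! ℕ.* factProd js)) * (pow R 1# j₀ * monomial)
            ≈⟨ *-cong (*-cong N!≈ (inv-* (ℕP.1≤n! j₀) (factProd-positive js))) (trans (*-congʳ (pow-1# j₀)) (*-identityˡ monomial)) ⟩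
          (fromℕ R (j₀ !) * ff) * (inv (j₀ !) * inv (factProd js)) * monomial
            ≈⟨ solve 5 (λ a f i c p → (a :* f) :* (i :* c) :* p := (a :* i) :* (c :* (f :* p))) refl (fromℕ R (j₀ !)) ff (inv (j₀ !)) (inv (factProd js)) monomial ⟩
          (fromℕ R (j₀ !) * inv (j₀ !)) * (inv (factProd js) * (ff * monomial))
            ≈⟨ trans (*-congʳ (inverseʳ (ℕP.1≤n! j₀))) (*-identityˡ _) ⟩
          inv (factProd js) * (ff * monomial) ∎

      rhs4p1≈ : rhs4p1 R inv k N M a ≈ Σ[ indices ] bellTerm
      rhs4p1≈ = begin
        Σ[ partitionsOf k ] rhsTerm               ≈⟨ Σ-filterᵇ (λ p → proj₁ p ≤ᵇ N) rhsTerm rhsTerm-tooLong (partitionsOf k) ⟩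
        Σ[ partitions ] rhsTerm                   ≈⟨ rsum-↭ (↭P.map⁺ rhsTerm (↭-sym map-partitionOf-↭)) ⟩
        rsum R (map rhsTerm (map partitionOf indices)) ≡⟨ ≡.cong (rsum R) (ListP.map-∘ indices) ⟨
        Σ[ indices ] (rhsTerm ∘ partitionOf)      ≈⟨ Σ-cong-∈ indices rhsTerm-partitionOf ⟩
        Σ[ indices ] bellTerm                     ∎

      -- bellIndices (k + N) N lists vectors of length (k + N) ∸ N + 1, which is only propositionally suc k.
      lhs4p1≈ : lhs4p1 R inv k N a ≈ Σ[ indices ] bellTerm
      lhs4p1≈ = reindex ((k ℕ.+ N) ∸ N ℕ.+ 1) (≡.trans (≡.cong (ℕ._+ 1) (ℕP.m+n∸n≡m k N)) (ℕP.+-comm k 1))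
        where
        reindex : ∀ D → D ≡ suc k →
          Σ[ filterᵇ (λ j → (Vec.sum j ≡ᵇ N) ∧ (wsumFrom 1 j ≡ᵇ k ℕ.+ N)) (vecsUpTo D N) ] bellTerm ≈ Σ[ indices ] bellTerm
        reindex .(suc k) ≡.refl = refl

theorem4p1 : ∀ {c ℓ} (R : CommutativeRing c ℓ)
    (inv : ℕ → CommutativeRing.Carrier R)
    → (∀ n → CommutativeRing._≈_ R (CommutativeRing._*_ R (fromℕ R (suc n)) (inv (suc n))) (CommutativeRing.1# R))
    → (k N : ℕ) (a : ℕ → CommutativeRing.Carrier R)
    → (M : ℕ) → N ≤ M
    → CommutativeRing._≈_ R (lhs4p1 R inv k N a) (rhs4p1 R inv k N M a)
theorem4p1 R inv inv-spec k N a M N≤M =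
  trans (lhs4p1≈ R inv inv-spec k N a N≤M) (sym (rhs4p1≈ R inv inv-spec k N a N≤M))
  where open CommutativeRing R using (trans; sym)
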